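{- Let $N$ be a finite set of items with sizes $s(i)>0$, let $f:2^N\to\mathbb{R}_{\ge0}$ be normalized, monotone, submodular with $f(\{j\})>0$ for all $j$ and curvature $c\in(0,1]$, let $\gamma>0$, and let $i_j,G_j,k,\delta_j,s_j,\chi_j,s^*_j$ and $\mathrm{Opt}$ be as in the context, with $G_k\ne\mathrm{Opt}$. Then for all $j\in\{1,\dots,k\}$ and all $l\in\{0,\dots,j\}$, $$f(G_j)\ge f(\mathrm{Opt})-\Bigl(\prod_{m=l+1}^{j}\Bigl(1-\frac{c\,s_m}{\gamma}\Bigr)\Bigr)\Bigl(f(\mathrm{Opt})-\sum_{m=1}^{l}\delta_m\Bigr)+\frac{1-c}{c}\,\frac{\gamma}{\gamma-s^*_l}\Bigl(1-\prod_{m=l+1}^{j}\Bigl(1-\frac{c\,s_m}{\gamma}\Bigr)\Bigr)\Bigl(f(\mathrm{Opt})-\sum_{m=1}^{l}\chi_m\delta_m\Bigr).$$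
   Context: $s(A)=\sum_{i\in A}s(i)$. $f$ normalized: $f(\emptyset)=0$; monotone: $f(A)\le f(B)$ for $A\subseteq B$; submodular: $f(A)+f(B)\ge f(A\cup B)+f(A\cap B)$. Curvature: $c=1-\min_{j\in N}\frac{f(N)-f(N\setminus\{j\})}{f(\{j\})}$. $\mathrm{Opt}$ maximizes $f(S)$ over $S\subseteq N$ with $s(S)\le\gamma$. Greedy order: $N_\gamma=\{i:s(i)\le\gamma\}$; $G_0=\emptyset$, for $j=1,\dots,|N_\gamma|$, $i_j$ maximizes $\frac{f(G_{j-1}\cup\{i\})-f(G_{j-1})}{s(i)}$ over $i\in N_\gamma\setminus G_{j-1}$, $G_j=G_{j-1}\cup\{i_j\}$; $k$ is the largest index with $s(G_k)\le\gamma$. Further $s_j=s(i_j)$, $\delta_j=f(G_j)-f(G_{j-1})$, $\chi_j=1$ if $i_j\in\mathrm{Opt}$ and $0$ otherwise, $s^*_j=s(\mathrm{Opt}\cap G_j)$. Empty sums are $0$ and empty products are $1$. -}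

module Defs where

open import Level using (0ℓ)
open import Data.Nat as ℕ using (ℕ; zero; suc; _≤ᵇ_)
open import Data.Bool using (Bool; true; false; if_then_else_)
open import Data.Fin using (Fin; zero; suc)
open import Data.Fin.Subset as Sub using (Subset; ⁅_⁆; _∪_; _∩_; _⊆_; ⊤; ⊥)
open import Data.List using (List; []; _∷_)
open import Data.Vec using ([]; _∷_)
open import Data.Product using (Σ; _×_; _,_; ∃)
open import Relation.Binary.PropositionalEquality using (_≡_; _≢_)
open import Relation.Nullary using (¬_)
open import Algebra.Structures using (IsCommutativeRing)
open import Relation.Binary.Structures using (IsTotalOrder)

-- An ordered field (ℝ is an instance).  The inverse is a total
-- operation, only specified on nonzero elements.

record OrderedField : Set₁ where
  infixl 6 _+_ _-_
  infixl 7 _*_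
  infix 4 _≤_ _<_
  field
    Carrier : Set
    _+_ _*_ : Carrier → Carrier → Carrier
    -_ : Carrier → Carrier
    0# 1# : Carrier
    _⁻¹ : Carrier → Carrier
    _≤_ : Carrier → Carrier → Set
    isCommutativeRing : IsCommutativeRing _≡_ _+_ _*_ -_ 0# 1#
    0≢1 : 0# ≢ 1#
    ⁻¹-inverse : ∀ x → x ≢ 0# → x * (x ⁻¹) ≡ 1#
    isTotalOrder : IsTotalOrder _≡_ _≤_
    +-mono-≤ : ∀ {x y} z → x ≤ y → x + z ≤ y + z
    *-nonneg : ∀ {x y} → 0# ≤ x → 0# ≤ y → 0# ≤ x * y

  _-_ : Carrier → Carrier → Carrier
  x - y = x + (- y)

  _/_ : Carrier → Carrier → Carrier
  x / y = x * (y ⁻¹)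

  _<_ : Carrier → Carrier → Set
  x < y = (x ≤ y) × (x ≢ y)

module Greedy (OF : OrderedField) where
  open OrderedField OF

  ΣFin : ∀ {n} → (Fin n → Carrier) → Carrier
  ΣFin {zero}  g = 0#
  ΣFin {suc n} g = g zero + ΣFin (λ i → g (suc i))

  -- Σ_{m=a+1}^{b} g m  (empty sum = 0)
  ΣR : (ℕ → Carrier) → ℕ → ℕ → Carrier
  ΣR g a zero    = 0#
  ΣR g a (suc b) = if a ≤ᵇ b then ΣR g a b + g (suc b) else 0#

  -- Π_{m=a+1}^{b} g m  (empty product = 1)
  ΠR : (ℕ → Carrier) → ℕ → ℕ → Carrier
  ΠR g a zero    = 1#
  ΠR g a (suc b) = if a ≤ᵇ b then ΠR g a b * g (suc b) else 1#

  module _ {n : ℕ} (s : Fin n → Carrier) (f : Subset n → Carrier) where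

    sz : Subset n → Carrier
    sz A = ΣFin (λ i → if Data.Vec.lookup A i then s i else 0#)
      where import Data.Vec

    Normalized : Set
    Normalized = f ⊥ ≡ 0#

    Monotone : Set
    Monotone = ∀ A B → A ⊆ B → f A ≤ f B

    Submodular : Set
    Submodular = ∀ A B → f (A ∪ B) + f (A ∩ B) ≤ f A + f B

    ratio : Subset n → Fin n → Carrier
    ratio A i = (f (A ∪ ⁅ i ⁆) - f A) / s i

    -- c = 1 - min_j (f(N) - f(N∖{j})) / f({j})
    IsCurvature : Carrier → Set
    IsCurvature c =
      (∀ j → 1# - c ≤ (f ⊤ - f (⊤ Sub.- j)) / f ⁅ j ⁆) ×
      ∃ (λ j → 1# - c ≡ (f ⊤ - f (⊤ Sub.- j)) / f ⁅ j ⁆)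

    IsOpt : Carrier → Subset n → Set
    IsOpt γ O = (sz O ≤ γ) × (∀ S → sz S ≤ γ → f S ≤ f O)

    -- `GreedyFrom γ G xs`: starting from the current set G, the list xs
    -- is a valid continuation of the greedy order (ties broken arbitrarily)
    -- that enumerates all remaining items of N_γ = {i : s(i) ≤ γ}.
    data GreedyFrom (γ : Carrier) (G : Subset n) : List (Fin n) → Set where
      done : (∀ i → s i ≤ γ → i Sub.∈ G) → GreedyFrom γ G []
      step : ∀ {x xs} → s x ≤ γ → ¬ (x Sub.∈ G) →
             (∀ y → s y ≤ γ → ¬ (y Sub.∈ G) → ratio G y ≤ ratio G x) →
             GreedyFrom γ (G ∪ ⁅ x ⁆) xs → GreedyFrom γ G (x ∷ xs)

    IsGreedyOrder : Carrier → List (Fin n) → Set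
    IsGreedyOrder γ xs = GreedyFrom γ ⊥ xs

    Gs : List (Fin n) → ℕ → Subset n
    Gs xs        zero    = ⊥
    Gs []        (suc j) = ⊥
    Gs (x ∷ xs)  (suc j) = ⁅ x ⁆ ∪ Gs xs j

    -- s_m = s(i_m) for 1 ≤ m ≤ |xs| (0 outside that range; never used there)
    sAt : List (Fin n) → ℕ → Carrier
    sAt xs       zero          = 0#
    sAt []       (suc m)       = 0#
    sAt (x ∷ xs) (suc zero)    = s x
    sAt (x ∷ xs) (suc (suc m)) = sAt xs (suc m)

    χAt : Subset n → List (Fin n) → ℕ → Carrier
    χAt O xs       zero          = 0#
    χAt O []       (suc m)       = 0#
    χAt O (x ∷ xs) (suc zero)    = if Data.Vec.lookup O x then 1# else 0#
      where import Data.Vec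
    χAt O (x ∷ xs) (suc (suc m)) = χAt O xs (suc m)

    δAt : List (Fin n) → ℕ → Carrier
    δAt xs zero    = 0#
    δAt xs (suc m) = f (Gs xs (suc m)) - f (Gs xs m)

    sStar : Subset n → List (Fin n) → ℕ → Carrier
    sStar O xs l = sz (O ∩ Gs xs l)

    IsK : Carrier → List (Fin n) → ℕ → Set
    IsK γ xs k = (k ℕ.≤ Data.List.length xs) × (sz (Gs xs k) ≤ γ) ×
                 (∀ k' → k' ℕ.≤ Data.List.length xs → sz (Gs xs k') ≤ γ → k' ℕ.≤ k)
      where import Data.List

-- The right-hand side is a potential Φ(l) of the first l greedy steps (j fixed); Φ(j) = f(G_j),
-- so it suffices that Φ(l) ≤ Φ(l+1) for l < j. For the (l+1)-st item i, of size x = s_{l+1} and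
-- gain δ = δ_{l+1}, the greedy choice bounds the marginal density of every element of Opt ∖ G_l
-- by δ / x, so by submodularity x (f(G_l ∪ Opt) - f(G_l)) ≤ (γ - s*_l) δ; curvature gives
-- f(G_l ∪ Opt) ≥ f(Opt) + (1-c)(f(G_l) - Σ_{m≤l} χ_m δ_m), because each item outside Opt still adds at
-- least (1-c) f({i}) ≥ (1-c) δ_m. The remaining product P = Π_{m=l+2}^{j} (1 - c s_m/γ) satisfies
-- γ (1 - P) ≤ c (s(G_j) - s(G_{l+1})) ≤ c (γ - s*_{l+1}) by Weierstrass' product inequality.
-- After clearing the denominators c, γ, γ - s*_l and γ - s*_{l+1} (positive because G_k ≠ Opt),
-- Φ(l+1) - Φ(l) is a sum of products of nonnegative quantities.
module Submission where

open import Defs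
open import Level using (0ℓ)
open import Algebra.Bundles using (CommutativeRing)
import Algebra.Properties.Ring as RingProperties
import Algebra.Solver.IdempotentCommutativeMonoid as ICM-Solver
import Algebra.Solver.Ring.NaturalCoefficients.Default as NaturalSolver
open import Data.Bool using (true; false; if_then_else_; _∨_; _∧_)
import Data.Bool.Properties as BoolP
open import Data.Empty using (⊥-elim)
open import Data.Fin using (Fin; zero; suc; _≟_)
import Data.Fin.Properties as FinP
open import Data.Fin.Subset as Sub using (Subset; ⁅_⁆; _∪_; _∩_; _⊆_; _∈_; _∉_; ⋃)
import Data.Fin.Subset.Properties as SubP
open import Data.List using (List; []; _∷_; length; tabulate)
open import Data.Nat as ℕ using (ℕ; zero; suc; z≤n; s≤s)
import Data.Nat.Properties as ℕP
open import Data.Product using (_×_; _,_; proj₁; proj₂; ∃)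
open import Data.Sum using (_⊎_; inj₁; inj₂)
open import Data.Vec using (Vec; lookup; map; allFin)
open import Data.Vec.N-ary using (N-ary; Eq; Eqʰ; curryⁿ; curryⁿ-cong; curryⁿ-cong⁻¹; Eqʰ-to-Eq; _$ⁿ_)
open import Data.Vec.Properties using ([]=⇒lookup; lookup⇒[]=; lookup-zipWith; tabulate∘lookup; tabulate-cong)
open import Function using (case_of_; _∘′_; Equivalence)
open import Relation.Binary.Bundles using (Poset)
open import Relation.Binary.PropositionalEquality
  using (_≡_; _≢_; refl; sym; trans; cong; cong₂; subst; subst₂; module ≡-Reasoning)
import Relation.Binary.Reasoning.PartialOrder as PartialOrderReasoning
import Relation.Binary.Reasoning.Setoid as SetoidReasoning
open import Relation.Binary.Structures using (IsTotalOrder)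
open import Relation.Nullary using (¬_; Dec; yes; no)

module RingSolver {a ℓ} (R : CommutativeRing a ℓ) where
  open CommutativeRing R renaming (refl to ≈-refl; sym to ≈-sym; trans to ≈-trans)
  open RingProperties ring using (-‿involutive; -‿+-comm; -‿distribˡ-*; -‿distribʳ-*; -0#≈0#)
  open SetoidReasoning setoid
  module ℕ-Solver = NaturalSolver commutativeSemiring
  open ℕ-Solver using (Polynomial; con) renaming (var to ℕvar; _:+_ to _⊕_; _:*_ to _⊗_; ⟦_⟧ to ⟦_⟧₊; ⟦_⟧↓ to ⟦_⟧₊↓)

  infix 8 :-_
  infixl 7 _:*_
  infixl 6 _:+_ _:-_
  infix 4 _:=_

  data Expr (n : ℕ) : Set where
    var : Fin n → Expr n
    :0 :1 : Expr n
    _:+_ _:*_ : Expr n → Expr n → Expr n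
    :-_ : Expr n → Expr n

  _:-_ : ∀ {n} → Expr n → Expr n → Expr n
  x :- y = x :+ :- y

  _:=_ : ∀ {n} → Expr n → Expr n → Expr n × Expr n
  _:=_ = _,_

  close : ∀ {A : Set} n → N-ary n (Expr n) A → A
  close n f = f $ⁿ map var (allFin n)

  ⟦_⟧ : ∀ {n} → Expr n → Vec Carrier n → Carrier
  ⟦ var i ⟧ ρ = lookup ρ i
  ⟦ :0 ⟧ ρ = 0#
  ⟦ :1 ⟧ ρ = 1#
  ⟦ x :+ y ⟧ ρ = ⟦ x ⟧ ρ + ⟦ y ⟧ ρ
  ⟦ x :* y ⟧ ρ = ⟦ x ⟧ ρ * ⟦ y ⟧ ρ
  ⟦ :- x ⟧ ρ = - ⟦ x ⟧ ρ

  -- Every ring expression is a formal difference pos e - neg e of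
  -- semiring polynomials, so ring identities reduce to semiring ones.
  pos neg : ∀ {n} → Expr n → Polynomial n
  pos (var i) = ℕvar i
  pos :0 = con 0
  pos :1 = con 1
  pos (x :+ y) = pos x ⊕ pos y
  pos (x :* y) = pos x ⊗ pos y ⊕ neg x ⊗ neg y
  pos (:- x) = neg x
  neg (var i) = con 0
  neg :0 = con 0
  neg :1 = con 0
  neg (x :+ y) = neg x ⊕ neg y
  neg (x :* y) = pos x ⊗ neg y ⊕ neg x ⊗ pos y
  neg (:- x) = pos x

  x≈x-0 : ∀ x → x ≈ x - 0#
  x≈x-0 x = ≈-sym (≈-trans (+-congˡ -0#≈0#) (+-identityʳ x))

  +-diff : ∀ p n p′ n′ → (p - n) + (p′ - n′) ≈ (p + p′) - (n + n′)
  +-diff p n p′ n′ = begin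
    (p - n) + (p′ - n′)    ≈⟨ ℕ-Solver.solve 4 (λ p m p′ m′ → (p ⊕ m) ⊕ (p′ ⊕ m′) ℕ-Solver.:= (p ⊕ p′) ⊕ (m ⊕ m′)) ≈-refl p (- n) p′ (- n′) ⟩
    (p + p′) + (- n + - n′) ≈⟨ +-congˡ (-‿+-comm n n′) ⟩
    (p + p′) - (n + n′)    ∎

  *-diff : ∀ p n p′ n′ → (p - n) * (p′ - n′) ≈ (p * p′ + n * n′) - (p * n′ + n * p′)
  *-diff p n p′ n′ = begin
    (p - n) * (p′ - n′)
      ≈⟨ ℕ-Solver.solve 4 (λ p m p′ m′ → (p ⊕ m) ⊗ (p′ ⊕ m′) ℕ-Solver.:= (p ⊗ p′ ⊕ m ⊗ m′) ⊕ (p ⊗ m′ ⊕ m ⊗ p′)) ≈-refl p (- n) p′ (- n′) ⟩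
    (p * p′ + - n * - n′) + (p * - n′ + - n * p′)
      ≈⟨ +-cong (+-congˡ -*-) (+-cong (≈-sym (-‿distribʳ-* p n′)) (≈-sym (-‿distribˡ-* n p′))) ⟩
    (p * p′ + n * n′) + (- (p * n′) + - (n * p′))
      ≈⟨ +-congˡ (-‿+-comm (p * n′) (n * p′)) ⟩
    (p * p′ + n * n′) - (p * n′ + n * p′) ∎
    where
    -*- : - n * - n′ ≈ n * n′
    -*- = ≈-trans (≈-sym (-‿distribˡ-* n (- n′))) (≈-trans (-‿cong (≈-sym (-‿distribʳ-* n n′))) (-‿involutive (n * n′)))

  -‿diff : ∀ p n → - (p - n) ≈ n - p
  -‿diff p n = begin
    - (p - n)   ≈⟨ -‿+-comm p (- n) ⟨
    - p + - - n ≈⟨ +-congˡ (-‿involutive n) ⟩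
    - p + n     ≈⟨ +-comm (- p) n ⟩
    n - p       ∎

  diff-cong : ∀ {p n p′ n′} → p + n′ ≈ p′ + n → p - n ≈ p′ - n′
  diff-cong {p} {n} {p′} {n′} eq = begin
    p - n                       ≈⟨ +-identityʳ (p - n) ⟨
    (p - n) + 0#                ≈⟨ +-congˡ (-‿inverseʳ n′) ⟨
    (p - n) + (n′ - n′)         ≈⟨ +-diff p n n′ n′ ⟩
    (p + n′) - (n + n′)         ≈⟨ +-cong eq (-‿cong (+-comm n n′)) ⟩
    (p′ + n) - (n′ + n)         ≈⟨ +-diff p′ n′ n n ⟨
    (p′ - n′) + (n - n)         ≈⟨ +-congˡ (-‿inverseʳ n) ⟩
    (p′ - n′) + 0#              ≈⟨ +-identityʳ (p′ - n′) ⟩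
    p′ - n′                     ∎

  ⟦⟧≈pos-neg : ∀ {n} (e : Expr n) ρ → ⟦ e ⟧ ρ ≈ ⟦ pos e ⟧₊ ρ - ⟦ neg e ⟧₊ ρ
  ⟦⟧≈pos-neg (var i) ρ = x≈x-0 _
  ⟦⟧≈pos-neg :0 ρ = x≈x-0 _
  ⟦⟧≈pos-neg :1 ρ = x≈x-0 _
  ⟦⟧≈pos-neg (x :+ y) ρ = ≈-trans (+-cong (⟦⟧≈pos-neg x ρ) (⟦⟧≈pos-neg y ρ)) (+-diff _ _ _ _)
  ⟦⟧≈pos-neg (x :* y) ρ = ≈-trans (*-cong (⟦⟧≈pos-neg x ρ) (⟦⟧≈pos-neg y ρ)) (*-diff _ _ _ _)
  ⟦⟧≈pos-neg (:- x) ρ = ≈-trans (-‿cong (⟦⟧≈pos-neg x ρ)) (-‿diff _ _)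

  prove : ∀ {n} (ρ : Vec Carrier n) (l r : Expr n) →
          ⟦ pos l ⊕ neg r ⟧₊↓ ρ ≈ ⟦ pos r ⊕ neg l ⟧₊↓ ρ → ⟦ l ⟧ ρ ≈ ⟦ r ⟧ ρ
  prove ρ l r hyp = begin
    ⟦ l ⟧ ρ                         ≈⟨ ⟦⟧≈pos-neg l ρ ⟩
    ⟦ pos l ⟧₊ ρ - ⟦ neg l ⟧₊ ρ     ≈⟨ diff-cong (ℕ-Solver.prove ρ (pos l ⊕ neg r) (pos r ⊕ neg l) hyp) ⟩
    ⟦ pos r ⟧₊ ρ - ⟦ neg r ⟧₊ ρ     ≈⟨ ⟦⟧≈pos-neg r ρ ⟨
    ⟦ r ⟧ ρ                         ∎

  solve : ∀ n (f : N-ary n (Expr n) (Expr n × Expr n)) →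
    let (l , r) = close n f in
    Eqʰ n _≈_ (curryⁿ ⟦ pos l ⊕ neg r ⟧₊↓) (curryⁿ ⟦ pos r ⊕ neg l ⟧₊↓) →
    Eq n _≈_ (curryⁿ ⟦ l ⟧) (curryⁿ ⟦ r ⟧)
  solve n f hyp = curryⁿ-cong _≈_ ⟦ l ⟧ ⟦ r ⟧ λ ρ →
      prove ρ l r (curryⁿ-cong⁻¹ _≈_ ⟦ pos l ⊕ neg r ⟧₊↓ ⟦ pos r ⊕ neg l ⟧₊↓ (Eqʰ-to-Eq n _≈_ hyp) ρ)
    where
    l r : Expr n
    l = proj₁ (close n f)
    r = proj₂ (close n f)

lookup≡false⇒∉ : ∀ {n} {p : Subset n} {x} → lookup p x ≡ false → x ∉ p
lookup≡false⇒∉ px≡false x∈p = case trans (sym ([]=⇒lookup x∈p)) px≡false of λ ()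

∉⇒lookup≡false : ∀ {n} {p : Subset n} {x} → x ∉ p → lookup p x ≡ false
∉⇒lookup≡false {p = p} {x} x∉p with lookup p x in px
... | true = ⊥-elim (x∉p (lookup⇒[]= x p px))
... | false = refl

≢⇒∃-differ : ∀ {n} {A B : Subset n} → A ≢ B → ∃ λ y → (y ∈ A × y ∉ B) ⊎ (y ∉ A × y ∈ B)
≢⇒∃-differ {n} {A} {B} A≢B with FinP.¬∀⟶∃¬ n (λ y → lookup A y ≡ lookup B y) (λ y → lookup A y BoolP.≟ lookup B y) (A≢B ∘′ ext)
  where
  ext : (∀ y → lookup A y ≡ lookup B y) → A ≡ B
  ext same = trans (sym (tabulate∘lookup A)) (trans (tabulate-cong same) (tabulate∘lookup B))
... | y , differ with lookup A y in y∈A? | lookup B y in y∈B?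
...   | true  | false = y , inj₁ (lookup⇒[]= y A y∈A? , lookup≡false⇒∉ y∈B?)
...   | false | true  = y , inj₂ (lookup≡false⇒∉ y∈A? , lookup⇒[]= y B y∈B?)
...   | true  | true  = ⊥-elim (differ refl)
...   | false | false = ⊥-elim (differ refl)

∪-monoʳ : ∀ {n} {A B C : Subset n} → A ⊆ B → C ∪ A ⊆ C ∪ B
∪-monoʳ {C = C} A⊆B x∈C∪A with SubP.x∈p∪q⁻ C _ x∈C∪A
... | inj₁ x∈C = SubP.p⊆p∪q _ x∈C
... | inj₂ x∈A = SubP.q⊆p∪q C _ (A⊆B x∈A)

∪-⁅⁆-⊆ : ∀ {n} {A C : Subset n} {y} → A ⊆ C → y ∈ C → A ∪ ⁅ y ⁆ ⊆ C
∪-⁅⁆-⊆ {A = A} {y = y} A⊆C y∈C x∈A∪⁅y⁆ with SubP.x∈p∪q⁻ A ⁅ y ⁆ x∈A∪⁅y⁆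
... | inj₁ x∈A = A⊆C x∈A
... | inj₂ x∈⁅y⁆ = subst (_∈ _) (sym (SubP.x∈⁅y⁆⇒x≡y y x∈⁅y⁆)) y∈C

⊆⇒∪≡ : ∀ {n} {A B : Subset n} → A ⊆ B → A ∪ B ≡ B
⊆⇒∪≡ {A = A} {B} A⊆B = SubP.⊆-antisym ∪⊆B (SubP.q⊆p∪q A B)
  where
  ∪⊆B : A ∪ B ⊆ B
  ∪⊆B x∈A∪B with SubP.x∈p∪q⁻ A B x∈A∪B
  ... | inj₁ x∈A = A⊆B x∈A
  ... | inj₂ x∈B = x∈B

x∈p⇒p∩⁅x⁆≡⁅x⁆ : ∀ {n} {p : Subset n} {x} → x ∈ p → p ∩ ⁅ x ⁆ ≡ ⁅ x ⁆
x∈p⇒p∩⁅x⁆≡⁅x⁆ {p = p} {x} x∈p = SubP.⊆-antisym (SubP.p∩q⊆q p ⁅ x ⁆) ⁅x⁆⊆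
  where
  ⁅x⁆⊆ : ⁅ x ⁆ ⊆ p ∩ ⁅ x ⁆
  ⁅x⁆⊆ y∈⁅x⁆ = SubP.x∈p∩q⁺ (subst (_∈ p) (sym (SubP.x∈⁅y⁆⇒x≡y x y∈⁅x⁆)) x∈p , y∈⁅x⁆)

x∉p⇒p∩⁅x⁆≡⊥ : ∀ {n} {p : Subset n} {x} → x ∉ p → p ∩ ⁅ x ⁆ ≡ Sub.⊥
x∉p⇒p∩⁅x⁆≡⊥ {p = p} {x} x∉p = SubP.⊆-antisym ⊆⊥ SubP.⊥⊆
  where
  ⊆⊥ : p ∩ ⁅ x ⁆ ⊆ Sub.⊥
  ⊆⊥ y∈p∩⁅x⁆ with SubP.x∈p∩q⁻ p ⁅ x ⁆ y∈p∩⁅x⁆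
  ... | y∈p , y∈⁅x⁆ = ⊥-elim (x∉p (subst (_∈ p) (SubP.x∈⁅y⁆⇒x≡y x y∈⁅x⁆) y∈p))

⊆-⋃-tabulate : ∀ {n m} (T : Fin m → Subset n) i → T i ⊆ ⋃ (tabulate T)
⊆-⋃-tabulate T zero = SubP.p⊆p∪q _
⊆-⋃-tabulate T (suc i) x∈Ti = SubP.q⊆p∪q (T zero) _ (⊆-⋃-tabulate (λ j → T (suc j)) i x∈Ti)

n<ᵇn≡false : ∀ n → (n ℕ.<ᵇ n) ≡ false
n<ᵇn≡false zero = refl
n<ᵇn≡false (suc n) = n<ᵇn≡false n

module ∪-Solver {n : ℕ} = ICM-Solver (SubP.∪-idempotentCommutativeMonoid n)

module _ (OF : OrderedField) where
  open OrderedField OF hiding (+-mono-≤)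
  open Greedy OF

  -- Ordered fields

  +-monoˡ-≤ : ∀ {x y} z → x ≤ y → x + z ≤ y + z
  +-monoˡ-≤ = OrderedField.+-mono-≤ OF

  commutativeRing : CommutativeRing 0ℓ 0ℓ
  commutativeRing = record { isCommutativeRing = isCommutativeRing }

  open CommutativeRing commutativeRing
    using (+-comm; *-comm; *-assoc; +-identityˡ; +-identityʳ; *-identityˡ; *-identityʳ; -‿inverseʳ)
  open RingSolver commutativeRing using (solve; _:+_; _:*_; _:-_; :-_; :0; :1; _:=_)
  open IsTotalOrder isTotalOrder
    using (antisym; total) renaming (refl to ≤-refl; trans to ≤-trans; reflexive to ≤-reflexive)

  ≤-poset : Poset 0ℓ 0ℓ 0ℓ
  ≤-poset = record { isPartialOrder = IsTotalOrder.isPartialOrder isTotalOrder }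

  module ≤-Reasoning = PartialOrderReasoning ≤-poset

  +-monoʳ-≤ : ∀ {x y} z → x ≤ y → z + x ≤ z + y
  +-monoʳ-≤ {x} {y} z x≤y = subst₂ _≤_ (+-comm x z) (+-comm y z) (+-monoˡ-≤ z x≤y)

  +-mono-≤ : ∀ {x y u v} → x ≤ y → u ≤ v → x + u ≤ y + v
  +-mono-≤ {y = y} {u = u} x≤y u≤v = ≤-trans (+-monoˡ-≤ u x≤y) (+-monoʳ-≤ y u≤v)

  +-nonneg : ∀ {x y} → 0# ≤ x → 0# ≤ y → 0# ≤ x + y
  +-nonneg 0≤x 0≤y = subst (_≤ _) (+-identityʳ 0#) (+-mono-≤ 0≤x 0≤y)

  x≤y⇒0≤y-x : ∀ {x y} → x ≤ y → 0# ≤ y - x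
  x≤y⇒0≤y-x {x} {y} x≤y = subst (_≤ y - x) (-‿inverseʳ x) (+-monoˡ-≤ (- x) x≤y)

  0≤y-x⇒x≤y : ∀ {y x} → 0# ≤ y - x → x ≤ y
  0≤y-x⇒x≤y {y} {x} 0≤y-x = subst₂ _≤_ (+-identityˡ x) y-x+x≡y (+-monoˡ-≤ x 0≤y-x)
    where
    y-x+x≡y : y - x + x ≡ y
    y-x+x≡y = solve 2 (λ y x → y :- x :+ x := y) refl y x

  -‿mono-≤ : ∀ {x y v u} → x ≤ y → v ≤ u → x - u ≤ y - v
  -‿mono-≤ {x} {y} {v} {u} x≤y v≤u = 0≤y-x⇒x≤y (subst (0# ≤_) rearrange (+-nonneg (x≤y⇒0≤y-x x≤y) (x≤y⇒0≤y-x v≤u)))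
    where
    rearrange : (y - x) + (u - v) ≡ (y - v) - (x - u)
    rearrange = solve 4 (λ x y v u → (y :- x) :+ (u :- v) := (y :- v) :- (x :- u)) refl x y v u

  *-monoʳ-≤-nonneg : ∀ {z x y} → 0# ≤ z → x ≤ y → x * z ≤ y * z
  *-monoʳ-≤-nonneg {z} {x} {y} 0≤z x≤y = 0≤y-x⇒x≤y (subst (0# ≤_) distrib (*-nonneg (x≤y⇒0≤y-x x≤y) 0≤z))
    where
    distrib : (y - x) * z ≡ y * z - x * z
    distrib = solve 3 (λ x y z → (y :- x) :* z := y :* z :- x :* z) refl x y z

  *-monoˡ-≤-nonneg : ∀ {z x y} → 0# ≤ z → x ≤ y → z * x ≤ z * y
  *-monoˡ-≤-nonneg {z} {x} {y} 0≤z x≤y = subst₂ _≤_ (*-comm x z) (*-comm y z) (*-monoʳ-≤-nonneg 0≤z x≤y)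

  0<x⇒x≢0 : ∀ {x} → 0# < x → x ≢ 0#
  0<x⇒x≢0 (_ , 0≢x) x≡0 = 0≢x (sym x≡0)

  -- If 1# ≤ 0# then 0# ≤ - 1#, hence 0# ≤ (- 1#) * (- 1#) = 1#.
  0≤1 : 0# ≤ 1#
  0≤1 with total 0# 1#
  ... | inj₁ 0≤1 = 0≤1
  ... | inj₂ 1≤0 = ⊥-elim (0≢1 (antisym (0≤y-x⇒x≤y 0≤1-0) 1≤0))
    where
    0≤-1 : 0# ≤ - 1#
    0≤-1 = subst₂ _≤_ (-‿inverseʳ 1#) (+-identityˡ (- 1#)) (+-monoˡ-≤ (- 1#) 1≤0)
    0≤1-0 : 0# ≤ 1# - 0#
    0≤1-0 = subst (0# ≤_) (solve 0 (:- :1 :* :- :1 := :1 :- :0) refl) (*-nonneg 0≤-1 0≤-1)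

  x/y*y≡x : ∀ {y x} → y ≢ 0# → x / y * y ≡ x
  x/y*y≡x {y} {x} y≢0 = begin
    x * y ⁻¹ * y   ≡⟨ solve 3 (λ x y y⁻¹ → x :* y⁻¹ :* y := x :* (y :* y⁻¹)) refl x y (y ⁻¹) ⟩
    x * (y * y ⁻¹) ≡⟨ cong (x *_) (⁻¹-inverse y y≢0) ⟩
    x * 1#         ≡⟨ *-identityʳ x ⟩
    x              ∎
    where open ≡-Reasoning

  0<x⇒0≤x⁻¹ : ∀ {x} → 0# < x → 0# ≤ x ⁻¹
  0<x⇒0≤x⁻¹ {x} 0<x with total 0# (x ⁻¹)
  ... | inj₁ 0≤x⁻¹ = 0≤x⁻¹
  ... | inj₂ x⁻¹≤0 = ⊥-elim (0≢1 (antisym 0≤1 (0≤y-x⇒x≤y 0≤0-1)))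
    where
    0≤-x⁻¹ : 0# ≤ - (x ⁻¹)
    0≤-x⁻¹ = subst (0# ≤_) (+-identityˡ (- (x ⁻¹))) (x≤y⇒0≤y-x x⁻¹≤0)
    0≤0-1 : 0# ≤ 0# - 1#
    0≤0-1 = subst (0# ≤_) eq (*-nonneg (proj₁ 0<x) 0≤-x⁻¹)
      where
      eq : x * - (x ⁻¹) ≡ 0# - 1#
      eq = begin
        x * - (x ⁻¹)   ≡⟨ solve 2 (λ x x⁻¹ → x :* :- x⁻¹ := :0 :- x :* x⁻¹) refl x (x ⁻¹) ⟩
        0# - x * x ⁻¹  ≡⟨ cong (λ t → 0# - t) (⁻¹-inverse x (0<x⇒x≢0 0<x)) ⟩
        0# - 1#        ∎
        where open ≡-Reasoning

  x/y-nonneg : ∀ {x y} → 0# ≤ x → 0# < y → 0# ≤ x / y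
  x/y-nonneg 0≤x 0<y = *-nonneg 0≤x (0<x⇒0≤x⁻¹ 0<y)

  x≤y⇒x/y≤1 : ∀ {y x} → 0# < y → x ≤ y → x / y ≤ 1#
  x≤y⇒x/y≤1 {y} 0<y x≤y = ≤-trans (*-monoʳ-≤-nonneg (0<x⇒0≤x⁻¹ 0<y) x≤y) (≤-reflexive (⁻¹-inverse y (0<x⇒x≢0 0<y)))

  *-cancelˡ-nonneg : ∀ {z x} → 0# < z → 0# ≤ z * x → 0# ≤ x
  *-cancelˡ-nonneg {z} {x} 0<z 0≤zx = subst (0# ≤_) (trans (*-comm (z * x) (z ⁻¹)) zx/z≡x) (x/y-nonneg 0≤zx 0<z)
    where
    zx/z≡x : z ⁻¹ * (z * x) ≡ x
    zx/z≡x = trans (solve 3 (λ z x z⁻¹ → z⁻¹ :* (z :* x) := x :* (z :* z⁻¹)) refl z x (z ⁻¹))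
                   (trans (cong (x *_) (⁻¹-inverse z (0<x⇒x≢0 0<z))) (*-identityʳ x))

  *-pos : ∀ {x y} → 0# < x → 0# < y → 0# < x * y
  *-pos {x} {y} 0<x 0<y = *-nonneg (proj₁ 0<x) (proj₁ 0<y) , λ 0≡xy → 0<x⇒x≢0 0<y (y≡0 (sym 0≡xy))
    where
    y≡0 : x * y ≡ 0# → y ≡ 0#
    y≡0 xy≡0 = begin
      y                ≡⟨ x/y*y≡x (0<x⇒x≢0 0<x) ⟨
      y / x * x        ≡⟨ solve 3 (λ x y x⁻¹ → y :* x⁻¹ :* x := x :* y :* x⁻¹) refl x y (x ⁻¹) ⟩
      x * y * x ⁻¹     ≡⟨ cong (_* x ⁻¹) xy≡0 ⟩
      0# * x ⁻¹        ≡⟨ solve 1 (λ t → :0 :* t := :0) refl (x ⁻¹) ⟩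
      0#               ∎
      where open ≡-Reasoning

  <-≤-trans : ∀ {x y z} → x < y → y ≤ z → x < z
  <-≤-trans (x≤y , x≢y) y≤z = ≤-trans x≤y y≤z , λ { refl → x≢y (antisym x≤y y≤z) }

  x+y≤z⇒y≤z-x : ∀ {x y z} → x + y ≤ z → y ≤ z - x
  x+y≤z⇒y≤z-x {x} {y} {z} x+y≤z = 0≤y-x⇒x≤y (subst (0# ≤_) (solve 3 (λ x y z → z :- (x :+ y) := z :- x :- y) refl x y z) (x≤y⇒0≤y-x x+y≤z))

  /≤/⇒*≤* : ∀ {y v x u} → 0# < y → 0# < v → x / y ≤ u / v → x * v ≤ u * y
  /≤/⇒*≤* {y} {v} {x} {u} 0<y 0<v x/y≤u/v =
    subst₂ _≤_ (clear x y v (0<x⇒x≢0 0<y)) (trans (cong (u / v *_) (*-comm y v)) (clear u v y (0<x⇒x≢0 0<v)))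
      (*-monoʳ-≤-nonneg (*-nonneg (proj₁ 0<y) (proj₁ 0<v)) x/y≤u/v)
    where
    clear : ∀ a b c → b ≢ 0# → a / b * (b * c) ≡ a * c
    clear a b c b≢0 = trans (solve 3 (λ a/b b c → a/b :* (b :* c) := a/b :* b :* c) refl (a / b) b c)
                            (cong (_* c) (x/y*y≡x b≢0))

  1-x∈[0,1] : ∀ {x} → 0# ≤ x → x ≤ 1# → 0# ≤ 1# - x × 1# - x ≤ 1#
  1-x∈[0,1] {x} 0≤x x≤1 = x≤y⇒0≤y-x x≤1 , subst (1# - x ≤_) (solve 0 (:1 :- :0 := :1) refl) (-‿mono-≤ ≤-refl 0≤x)

  +-cancelʳ-≤ : ∀ {x y} z → x + z ≤ y + z → x ≤ y
  +-cancelʳ-≤ {x} {y} z x+z≤y+z = subst₂ _≤_ (cancel x) (cancel y) (+-monoˡ-≤ (- z) x+z≤y+z)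
    where
    cancel : ∀ t → t + z - z ≡ t
    cancel t = solve 2 (λ t z → t :+ z :- z := t) refl t z

  x≤x+y : ∀ {y x} → 0# ≤ y → x ≤ x + y
  x≤x+y {y} {x} 0≤y = subst (_≤ x + y) (+-identityʳ x) (+-monoʳ-≤ x 0≤y)

  x+y≤z⇒x≤z-y : ∀ {x y z} → x + y ≤ z → x ≤ z - y
  x+y≤z⇒x≤z-y {x} {y} x+y≤z = x+y≤z⇒y≤z-x (subst (_≤ _) (+-comm x y) x+y≤z)

  x≤y+z⇒x-y≤z : ∀ {x y z} → x ≤ y + z → x - y ≤ z
  x≤y+z⇒x-y≤z {x} {y} {z} x≤y+z = subst (x - y ≤_) (solve 2 (λ y z → y :+ z :- y := z) refl y z) (+-monoˡ-≤ (- y) x≤y+z)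

  ≤-chain : ∀ (g : ℕ → Carrier) {l j} → (∀ {m} → l ℕ.≤ m → m ℕ.< j → g m ≤ g (suc m)) → l ℕ.≤ j → g l ≤ g j
  ≤-chain g {j = zero} _ z≤n = ≤-refl
  ≤-chain g {l} {suc j} ascends l≤1+j with ℕP.m≤n⇒m<n∨m≡n l≤1+j
  ... | inj₂ refl = ≤-refl
  ... | inj₁ (s≤s l≤j) = ≤-trans (≤-chain g (λ l≤m m<j → ascends l≤m (ℕP.m<n⇒m<1+n m<j)) l≤j) (ascends l≤j ℕP.≤-refl)

  -- Sums over subsets and products over ranges

  ΣFin-cong : ∀ {m} {g h : Fin m → Carrier} → (∀ i → g i ≡ h i) → ΣFin g ≡ ΣFin h
  ΣFin-cong {zero} g≗h = refl
  ΣFin-cong {suc m} g≗h = cong₂ _+_ (g≗h zero) (ΣFin-cong (λ i → g≗h (suc i)))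

  ΣFin-mono : ∀ {m} {g h : Fin m → Carrier} → (∀ i → g i ≤ h i) → ΣFin g ≤ ΣFin h
  ΣFin-mono {zero} g≤h = ≤-refl
  ΣFin-mono {suc m} g≤h = +-mono-≤ (g≤h zero) (ΣFin-mono (λ i → g≤h (suc i)))

  ΣFin-+ : ∀ {m} (g h : Fin m → Carrier) → ΣFin (λ i → g i + h i) ≡ ΣFin g + ΣFin h
  ΣFin-+ {zero} g h = solve 0 (:0 := :0 :+ :0) refl
  ΣFin-+ {suc m} g h = trans (cong (g zero + h zero +_) (ΣFin-+ (λ i → g (suc i)) (λ i → h (suc i))))
    (solve 4 (λ a b c d → a :+ b :+ (c :+ d) := a :+ c :+ (b :+ d)) refl (g zero) (h zero) _ _)

  ΣFin-*ˡ : ∀ {m} (x : Carrier) (g : Fin m → Carrier) → ΣFin (λ i → x * g i) ≡ x * ΣFin g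
  ΣFin-*ˡ {zero} x g = solve 1 (λ x → :0 := x :* :0) refl x
  ΣFin-*ˡ {suc m} x g = trans (cong (x * g zero +_) (ΣFin-*ˡ x (λ i → g (suc i))))
    (solve 3 (λ x a b → x :* a :+ x :* b := x :* (a :+ b)) refl x (g zero) _)

  restrict : ∀ {n} → Subset n → (Fin n → Carrier) → Fin n → Carrier
  restrict A g i = if lookup A i then g i else 0#

  -- `sz s f A` unfolds to `ΣIn A s`.
  ΣIn : ∀ {n} → Subset n → (Fin n → Carrier) → Carrier
  ΣIn A g = ΣFin (restrict A g)

  ΣIn-⊥ : ∀ {n} (g : Fin n → Carrier) → ΣIn Sub.⊥ g ≡ 0#
  ΣIn-⊥ {zero} g = refl
  ΣIn-⊥ {suc n} g = trans (+-identityˡ _) (ΣIn-⊥ (λ i → g (suc i)))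

  ΣIn-⁅⁆ : ∀ {n} (g : Fin n → Carrier) i → ΣIn ⁅ i ⁆ g ≡ g i
  ΣIn-⁅⁆ g zero = trans (cong (g zero +_) (ΣIn-⊥ (λ i → g (suc i)))) (+-identityʳ (g zero))
  ΣIn-⁅⁆ g (suc i) = trans (+-identityˡ _) (ΣIn-⁅⁆ (λ j → g (suc j)) i)

  ΣIn-∪-⁅⁆ : ∀ {n} (g : Fin n → Carrier) {A i} → i ∉ A → ΣIn (A ∪ ⁅ i ⁆) g ≡ ΣIn A g + g i
  ΣIn-∪-⁅⁆ g {A} {i} i∉A = begin
    ΣIn (A ∪ ⁅ i ⁆) g   ≡⟨ trans (ΣFin-cong split) (ΣFin-+ (restrict A g) (restrict ⁅ i ⁆ g)) ⟩
    ΣIn A g + ΣIn ⁅ i ⁆ g ≡⟨ cong (ΣIn A g +_) (ΣIn-⁅⁆ g i) ⟩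
    ΣIn A g + g i       ∎
    where
    open ≡-Reasoning
    split : ∀ j → restrict (A ∪ ⁅ i ⁆) g j ≡ restrict A g j + restrict ⁅ i ⁆ g j
    split j rewrite lookup-zipWith _∨_ j A ⁅ i ⁆ with lookup A j in j∈A | lookup ⁅ i ⁆ j in j∈⁅i⁆
    ... | true  | true  = ⊥-elim (i∉A (subst (_∈ A) (SubP.x∈⁅y⁆⇒x≡y i (lookup⇒[]= j _ j∈⁅i⁆)) (lookup⇒[]= j A j∈A)))
    ... | true  | false = sym (+-identityʳ (g j))
    ... | false | true  = sym (+-identityˡ (g j))
    ... | false | false = sym (+-identityˡ 0#)

  ΣIn-mono-⊆ : ∀ {n} {g : Fin n → Carrier} {A B} → (∀ i → 0# ≤ g i) → A ⊆ B → ΣIn A g ≤ ΣIn B g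
  ΣIn-mono-⊆ {g = g} {A} {B} 0≤g A⊆B = ΣFin-mono pointwise
    where
    pointwise : ∀ i → restrict A g i ≤ restrict B g i
    pointwise i with lookup A i in i∈A | lookup B i in i∈B
    ... | true  | true  = ≤-refl
    ... | true  | false = case trans (sym ([]=⇒lookup (A⊆B (lookup⇒[]= i A i∈A)))) i∈B of λ ()
    ... | false | true  = 0≤g i
    ... | false | false = ≤-refl

  ΣIn-nonneg : ∀ {n} {g : Fin n → Carrier} A → (∀ i → 0# ≤ g i) → 0# ≤ ΣIn A g
  ΣIn-nonneg {g = g} A 0≤g = subst (_≤ ΣIn A g) (ΣIn-⊥ g) (ΣIn-mono-⊆ {A = Sub.⊥} {B = A} 0≤g SubP.⊥⊆)

  restrict≡indicator* : ∀ {n} (A : Subset n) g i → restrict A g i ≡ (if lookup A i then 1# else 0#) * g i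
  restrict≡indicator* A g i with lookup A i
  ... | true = sym (*-identityˡ (g i))
  ... | false = solve 1 (λ x → :0 := :0 :* x) refl (g i)

  ΣIn-∩-∪-⁅⁆ : ∀ {n} (g : Fin n → Carrier) (O : Subset n) {A i} → i ∉ A →
               ΣIn (O ∩ (A ∪ ⁅ i ⁆)) g ≡ ΣIn (O ∩ A) g + restrict O g i
  ΣIn-∩-∪-⁅⁆ g O {A} {i} i∉A =
    trans (cong (λ B → ΣIn B g) (SubP.∩-distribˡ-∪ O A ⁅ i ⁆)) (by-cases (lookup O i) refl)
    where
    open ≡-Reasoning
    by-cases : ∀ b → lookup O i ≡ b → ΣIn ((O ∩ A) ∪ (O ∩ ⁅ i ⁆)) g ≡ ΣIn (O ∩ A) g + restrict O g i
    by-cases true i∈O = begin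
      ΣIn ((O ∩ A) ∪ (O ∩ ⁅ i ⁆)) g   ≡⟨ cong (λ B → ΣIn ((O ∩ A) ∪ B) g) (x∈p⇒p∩⁅x⁆≡⁅x⁆ (lookup⇒[]= i O i∈O)) ⟩
      ΣIn ((O ∩ A) ∪ ⁅ i ⁆) g         ≡⟨ ΣIn-∪-⁅⁆ g (λ i∈O∩A → i∉A (proj₂ (SubP.x∈p∩q⁻ O A i∈O∩A))) ⟩
      ΣIn (O ∩ A) g + g i             ≡⟨ cong (λ b → ΣIn (O ∩ A) g + (if b then g i else 0#)) i∈O ⟨
      ΣIn (O ∩ A) g + restrict O g i  ∎
    by-cases false i∉O = begin
      ΣIn ((O ∩ A) ∪ (O ∩ ⁅ i ⁆)) g   ≡⟨ cong (λ B → ΣIn ((O ∩ A) ∪ B) g) (x∉p⇒p∩⁅x⁆≡⊥ (lookup≡false⇒∉ i∉O)) ⟩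
      ΣIn ((O ∩ A) ∪ Sub.⊥) g         ≡⟨ cong (λ B → ΣIn B g) (SubP.∪-identityʳ (O ∩ A)) ⟩
      ΣIn (O ∩ A) g                   ≡⟨ +-identityʳ _ ⟨
      ΣIn (O ∩ A) g + 0#              ≡⟨ cong (λ b → ΣIn (O ∩ A) g + (if b then g i else 0#)) i∉O ⟨
      ΣIn (O ∩ A) g + restrict O g i  ∎

  ΠR-empty : ∀ g j → ΠR g j j ≡ 1#
  ΠR-empty g zero = refl
  ΠR-empty g (suc j) rewrite n<ᵇn≡false j = refl

  ΠR-snoc : ∀ g {l j} → l ℕ.≤ j → ΠR g l (suc j) ≡ ΠR g l j * g (suc j)
  ΠR-snoc g l≤j rewrite Equivalence.to BoolP.T-≡ (ℕP.≤⇒≤ᵇ l≤j) = refl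

  ΠR-cons : ∀ g {l j} → l ℕ.< j → ΠR g l j ≡ g (suc l) * ΠR g (suc l) j
  ΠR-cons g {l} {suc j} (s≤s l≤j) with ℕP.m≤n⇒m<n∨m≡n l≤j
  ... | inj₂ refl = begin
    ΠR g l (suc l)             ≡⟨ ΠR-snoc g l≤j ⟩
    ΠR g l l * g (suc l)       ≡⟨ cong (_* g (suc l)) (ΠR-empty g l) ⟩
    1# * g (suc l)             ≡⟨ solve 1 (λ x → :1 :* x := x :* :1) refl (g (suc l)) ⟩
    g (suc l) * 1#             ≡⟨ cong (g (suc l) *_) (ΠR-empty g (suc l)) ⟨
    g (suc l) * ΠR g (suc l) (suc l) ∎
    where open ≡-Reasoning
  ... | inj₁ l<j = begin
    ΠR g l (suc j)                        ≡⟨ ΠR-snoc g l≤j ⟩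
    ΠR g l j * g (suc j)                  ≡⟨ cong (_* g (suc j)) (ΠR-cons g l<j) ⟩
    g (suc l) * ΠR g (suc l) j * g (suc j) ≡⟨ *-assoc _ _ _ ⟩
    g (suc l) * (ΠR g (suc l) j * g (suc j)) ≡⟨ cong (g (suc l) *_) (ΠR-snoc g l<j) ⟨
    g (suc l) * ΠR g (suc l) (suc j)      ∎
    where open ≡-Reasoning

  ΠR-∈[0,1] : ∀ g {l j} → l ℕ.≤ j → (∀ {m} → l ℕ.≤ m → m ℕ.< j → 0# ≤ g (suc m) × g (suc m) ≤ 1#) →
              0# ≤ ΠR g l j × ΠR g l j ≤ 1#
  ΠR-∈[0,1] g {j = zero} z≤n _ = 0≤1 , ≤-refl
  ΠR-∈[0,1] g {l} {suc j} l≤1+j g∈[0,1] with ℕP.m≤n⇒m<n∨m≡n l≤1+j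
  ... | inj₂ refl = subst (λ p → 0# ≤ p × p ≤ 1#) (sym (ΠR-empty g l)) (0≤1 , ≤-refl)
  ... | inj₁ (s≤s l≤j) = subst (λ p → 0# ≤ p × p ≤ 1#) (sym (ΠR-snoc g l≤j))
          (*-nonneg 0≤Π 0≤g , ≤-trans (*-monoˡ-≤-nonneg 0≤Π g≤1) (≤-trans (≤-reflexive (*-identityʳ _)) Π≤1))
    where
    Π-bounds : 0# ≤ ΠR g l j × ΠR g l j ≤ 1#
    Π-bounds = ΠR-∈[0,1] g l≤j (λ l≤m m<j → g∈[0,1] l≤m (ℕP.m<n⇒m<1+n m<j))
    0≤Π : 0# ≤ ΠR g l j
    0≤Π = proj₁ Π-bounds
    Π≤1 : ΠR g l j ≤ 1#
    Π≤1 = proj₂ Π-bounds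
    0≤g : 0# ≤ g (suc j)
    0≤g = proj₁ (g∈[0,1] l≤j ℕP.≤-refl)
    g≤1 : g (suc j) ≤ 1#
    g≤1 = proj₂ (g∈[0,1] l≤j ℕP.≤-refl)

  -- Weierstrass' product inequality 1 - Π (1 - eₘ) ≤ Σ eₘ, weighted by w and with the sum telescoped through T.
  1-ΠR≤ : ∀ (e T : ℕ → Carrier) {w l j} → 0# ≤ w → l ℕ.≤ j →
          (∀ {m} → l ℕ.≤ m → m ℕ.< j → 0# ≤ e (suc m) × e (suc m) ≤ 1# × w * e (suc m) ≤ T (suc m) - T m) →
          w * (1# - ΠR (λ m → 1# - e m) l j) ≤ T j - T l
  1-ΠR≤ e T {w} {j = zero} 0≤w z≤n _ = ≤-reflexive (solve 2 (λ w t → w :* (:1 :- :1) := t :- t) refl w (T 0))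
  1-ΠR≤ e T {w} {l} {suc j} 0≤w l≤1+j e-bounds with ℕP.m≤n⇒m<n∨m≡n l≤1+j
  ... | inj₂ refl = ≤-reflexive (trans (cong (λ p → w * (1# - p)) (ΠR-empty (λ m → 1# - e m) l))
                                       (solve 2 (λ w t → w :* (:1 :- :1) := t :- t) refl w (T l)))
  ... | inj₁ (s≤s l≤j) = begin
    w * (1# - ΠR (λ m → 1# - e m) l (suc j))  ≡⟨ cong (λ p → w * (1# - p)) (ΠR-snoc (λ m → 1# - e m) l≤j) ⟩
    w * (1# - P * (1# - e (suc j)))           ≡⟨ solve 3 (λ w P x → w :* (:1 :- P :* (:1 :- x)) := w :* (:1 :- P) :+ P :* (w :* x)) refl w P (e (suc j)) ⟩
    w * (1# - P) + P * (w * e (suc j))        ≤⟨ +-mono-≤ ih (*-monoʳ-≤-nonneg (*-nonneg 0≤w 0≤e) P≤1) ⟩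
    (T j - T l) + 1# * (w * e (suc j))        ≤⟨ +-monoʳ-≤ (T j - T l) (≤-trans (≤-reflexive (*-identityˡ _)) we≤ΔT) ⟩
    (T j - T l) + (T (suc j) - T j)           ≡⟨ solve 3 (λ a b c → b :- a :+ (c :- b) := c :- a) refl (T l) (T j) (T (suc j)) ⟩
    T (suc j) - T l                           ∎
    where
    open ≤-Reasoning
    P : Carrier
    P = ΠR (λ m → 1# - e m) l j
    e-bounds′ : ∀ {m} → l ℕ.≤ m → m ℕ.< j → 0# ≤ e (suc m) × e (suc m) ≤ 1# × w * e (suc m) ≤ T (suc m) - T m
    e-bounds′ l≤m m<j = e-bounds l≤m (ℕP.m<n⇒m<1+n m<j)
    ih : w * (1# - P) ≤ T j - T l
    ih = 1-ΠR≤ e T 0≤w l≤j e-bounds′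
    P≤1 : P ≤ 1#
    P≤1 = proj₂ (ΠR-∈[0,1] (λ m → 1# - e m) l≤j (λ l≤m m<j → let (0≤x , x≤1 , _) = e-bounds′ l≤m m<j in 1-x∈[0,1] 0≤x x≤1))
    0≤e : 0# ≤ e (suc j)
    0≤e = proj₁ (e-bounds l≤j ℕP.≤-refl)
    we≤ΔT : w * e (suc j) ≤ T (suc j) - T j
    we≤ΔT = proj₂ (proj₂ (e-bounds l≤j ℕP.≤-refl))

  module SubmodularProperties {n : ℕ} (f : Subset n → Carrier)
    (f-mono : ∀ A B → A ⊆ B → f A ≤ f B)
    (f-submodular : ∀ A B → f (A ∪ B) + f (A ∩ B) ≤ f A + f B) where

    diminishing-returns : ∀ {A A′ B} → A ⊆ A′ ∩ B → f (A′ ∪ B) - f B ≤ f A′ - f A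
    diminishing-returns {A} {A′} {B} A⊆A′∩B = +-cancelʳ-≤ (f B + f A) (begin
      f (A′ ∪ B) - f B + (f B + f A)   ≡⟨ solve 3 (λ u b a → u :- b :+ (b :+ a) := u :+ a) refl (f (A′ ∪ B)) (f B) (f A) ⟩
      f (A′ ∪ B) + f A                 ≤⟨ +-monoʳ-≤ (f (A′ ∪ B)) (f-mono _ _ A⊆A′∩B) ⟩
      f (A′ ∪ B) + f (A′ ∩ B)          ≤⟨ f-submodular A′ B ⟩
      f A′ + f B                       ≡⟨ solve 3 (λ a′ b a → a′ :+ b := a′ :- a :+ (b :+ a)) refl (f A′) (f B) (f A) ⟩
      f A′ - f A + (f B + f A)         ∎)
      where open ≤-Reasoning

    submodular-⋃ : ∀ G {m} (T : Fin m → Subset n) → f (G ∪ ⋃ (tabulate T)) ≤ f G + ΣFin (λ i → f (G ∪ T i) - f G)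
    submodular-⋃ G {zero} T = ≤-reflexive (trans (cong f (SubP.∪-identityʳ G)) (sym (+-identityʳ (f G))))
    submodular-⋃ G {suc m} T = begin
      f (G ∪ (T zero ∪ U))                ≡⟨ cong f regroup ⟩
      f (A′ ∪ B)                          ≡⟨ solve 2 (λ x b → x := x :- b :+ b) refl (f (A′ ∪ B)) (f B) ⟩
      f (A′ ∪ B) - f B + f B              ≤⟨ +-monoˡ-≤ (f B) (diminishing-returns G⊆A′∩B) ⟩
      f A′ - f G + f B                    ≤⟨ +-monoʳ-≤ (f A′ - f G) (submodular-⋃ G (λ i → T (suc i))) ⟩
      f A′ - f G + (f G + Σ)              ≡⟨ solve 3 (λ a g s → a :- g :+ (g :+ s) := g :+ (a :- g :+ s)) refl (f A′) (f G) Σ ⟩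
      f G + (f A′ - f G + Σ)              ∎
      where
      open ≤-Reasoning
      U A′ B : Subset n
      U = ⋃ (tabulate (λ i → T (suc i)))
      A′ = G ∪ T zero
      B = G ∪ U
      Σ : Carrier
      Σ = ΣFin (λ i → f (G ∪ T (suc i)) - f G)
      regroup : G ∪ (T zero ∪ U) ≡ A′ ∪ B
      regroup = ∪-Solver.solve 3 (λ g t u → g ⊕ (t ⊕ u) ⊜ (g ⊕ t) ⊕ (g ⊕ u)) refl G (T zero) U
        where open ∪-Solver
      G⊆A′∩B : G ⊆ A′ ∩ B
      G⊆A′∩B x∈G = SubP.x∈p∩q⁺ (SubP.p⊆p∪q (T zero) x∈G , SubP.p⊆p∪q U x∈G)

    marginal≤singleton : (∀ A → 0# ≤ f A) → ∀ G i → f (G ∪ ⁅ i ⁆) - f G ≤ f ⁅ i ⁆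
    marginal≤singleton f≥0 G i = begin
      f (G ∪ ⁅ i ⁆) - f G                          ≤⟨ +-monoˡ-≤ (- f G) (x≤x+y (f≥0 (G ∩ ⁅ i ⁆))) ⟩
      f (G ∪ ⁅ i ⁆) + f (G ∩ ⁅ i ⁆) - f G          ≤⟨ +-monoˡ-≤ (- f G) (f-submodular G ⁅ i ⁆) ⟩
      f G + f ⁅ i ⁆ - f G                          ≡⟨ solve 2 (λ g x → g :+ x :- g := x) refl (f G) (f ⁅ i ⁆) ⟩
      f ⁅ i ⁆                                      ∎
      where open ≤-Reasoning

    curvature-marginal : ∀ {c i A} → 0# < f ⁅ i ⁆ → 1# - c ≤ (f Sub.⊤ - f (Sub.⊤ Sub.- i)) / f ⁅ i ⁆ → i ∉ A →
                         (1# - c) * f ⁅ i ⁆ ≤ f (A ∪ ⁅ i ⁆) - f A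
    curvature-marginal {c} {i} {A} 0<fi 1-c≤κ i∉A = begin
      (1# - c) * f ⁅ i ⁆                         ≤⟨ *-monoʳ-≤-nonneg (proj₁ 0<fi) 1-c≤κ ⟩
      (f Sub.⊤ - f (Sub.⊤ Sub.- i)) / f ⁅ i ⁆ * f ⁅ i ⁆ ≡⟨ x/y*y≡x (0<x⇒x≢0 0<fi) ⟩
      f Sub.⊤ - f (Sub.⊤ Sub.- i)                ≡⟨ cong (λ X → f X - f (Sub.⊤ Sub.- i)) ⊤≡ ⟩
      f ((A ∪ ⁅ i ⁆) ∪ (Sub.⊤ Sub.- i)) - f (Sub.⊤ Sub.- i) ≤⟨ diminishing-returns A⊆ ⟩
      f (A ∪ ⁅ i ⁆) - f A                        ∎
      where
      open ≤-Reasoning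
      ⊤≡ : Sub.⊤ ≡ (A ∪ ⁅ i ⁆) ∪ (Sub.⊤ Sub.- i)
      ⊤≡ = SubP.⊆-antisym covered SubP.⊆⊤
        where
        covered : Sub.⊤ ⊆ (A ∪ ⁅ i ⁆) ∪ (Sub.⊤ Sub.- i)
        covered {x} _ with x ≟ i
        ... | yes refl = SubP.p⊆p∪q _ (SubP.q⊆p∪q A ⁅ i ⁆ (SubP.x∈⁅x⁆ i))
        ... | no x≢i = SubP.q⊆p∪q _ _ (SubP.x∈p∧x≢y⇒x∈p-y SubP.∈⊤ x≢i)
      A⊆ : A ⊆ (A ∪ ⁅ i ⁆) ∩ (Sub.⊤ Sub.- i)
      A⊆ {x} x∈A = SubP.x∈p∩q⁺ (SubP.p⊆p∪q ⁅ i ⁆ x∈A , SubP.x∈p∧x≢y⇒x∈p-y SubP.∈⊤ λ { refl → i∉A x∈A })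

    elements : Subset n → Fin n → Subset n
    elements A y = if lookup A y then ⁅ y ⁆ else Sub.⊥

    submodular-elements : ∀ G A → f (G ∪ A) ≤ f G + ΣFin (λ y → f (G ∪ elements A y) - f G)
    submodular-elements G A = ≤-trans (f-mono _ _ (∪-monoʳ A⊆⋃)) (submodular-⋃ G (elements A))
      where
      A⊆⋃ : A ⊆ ⋃ (tabulate (elements A))
      A⊆⋃ {y} y∈A = ⊆-⋃-tabulate (elements A) y (subst (λ b → y ∈ (if b then ⁅ y ⁆ else Sub.⊥)) (sym ([]=⇒lookup y∈A)) (SubP.x∈⁅x⁆ y))

  module GreedySequence {n : ℕ} (s : Fin n → Carrier) (f : Subset n → Carrier) (γ : Carrier) (O : Subset n) where

    record Choice (H H′ : Subset n) (sᵢ χᵢ : Carrier) : Set where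
      field
        item : Fin n
        fits : s item ≤ γ
        fresh : item ∉ H
        best : ∀ y → s y ≤ γ → y ∉ H → ratio s f H y ≤ ratio s f H item
        extends : H′ ≡ H ∪ ⁅ item ⁆
        size : sᵢ ≡ s item
        indicator : χᵢ ≡ (if lookup O item then 1# else 0#)

      indicator-∈ : item ∈ O → χᵢ ≡ 1#
      indicator-∈ item∈O = trans indicator (cong (λ b → if b then 1# else 0#) ([]=⇒lookup item∈O))

      indicator-∉ : item ∉ O → χᵢ ≡ 0#
      indicator-∉ item∉O = trans indicator (cong (λ b → if b then 1# else 0#) (∉⇒lookup≡false item∉O))

    choice-from : ∀ {B ys m} → GreedyFrom s f γ B ys → m ℕ.< length ys →
      Choice (B ∪ Gs s f ys m) (B ∪ Gs s f ys (suc m)) (sAt s f ys (suc m)) (χAt s f O ys (suc m))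
    choice-from {B} {x ∷ ys} {zero} (GreedyFrom.step fits fresh best _) _ =
      subst₂ (λ H H′ → Choice H H′ (s x) (if lookup O x then 1# else 0#)) (sym (SubP.∪-identityʳ B)) (cong (B ∪_) (sym (SubP.∪-identityʳ ⁅ x ⁆)))
        (record { item = x ; fits = fits ; fresh = fresh ; best = best ; extends = refl ; size = refl ; indicator = refl })
    choice-from {B} {x ∷ ys} {suc m} (GreedyFrom.step _ _ _ rest) (s≤s m<len) =
      subst₂ (λ H H′ → Choice H H′ (sAt s f ys (suc m)) (χAt s f O ys (suc m)))
        (SubP.∪-assoc B ⁅ x ⁆ _) (SubP.∪-assoc B ⁅ x ⁆ _) (choice-from rest m<len)

    choice : ∀ {xs m} → IsGreedyOrder s f γ xs → m ℕ.< length xs →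
      Choice (Gs s f xs m) (Gs s f xs (suc m)) (sAt s f xs (suc m)) (χAt s f O xs (suc m))
    choice {xs} {m} greedy m<len =
      subst₂ (λ H H′ → Choice H H′ (sAt s f xs (suc m)) (χAt s f O xs (suc m)))
        (SubP.∪-identityˡ _) (SubP.∪-identityˡ _) (choice-from greedy m<len)

    Gs-mono : ∀ xs {m m′} → m ℕ.≤ m′ → Gs s f xs m ⊆ Gs s f xs m′
    Gs-mono xs {zero} _ = SubP.⊥⊆
    Gs-mono [] {suc m} _ = SubP.⊥⊆
    Gs-mono (x ∷ xs) {suc m} {suc m′} (s≤s m≤m′) y∈ with SubP.x∈p∪q⁻ ⁅ x ⁆ _ y∈
    ... | inj₁ y∈⁅x⁆ = SubP.p⊆p∪q _ y∈⁅x⁆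
    ... | inj₂ y∈G = SubP.q⊆p∪q ⁅ x ⁆ _ (Gs-mono xs m≤m′ y∈G)

    χAt∈[0,1] : ∀ ys m → 0# ≤ χAt s f O ys m × χAt s f O ys m ≤ 1#
    χAt∈[0,1] ys zero = ≤-refl , 0≤1
    χAt∈[0,1] [] (suc m) = ≤-refl , 0≤1
    χAt∈[0,1] (y ∷ ys) (suc zero) with lookup O y
    ... | true = 0≤1 , ≤-refl
    ... | false = ≤-refl , 0≤1
    χAt∈[0,1] (y ∷ ys) (suc (suc m)) = χAt∈[0,1] ys (suc m)

  module Potential (F γ c : Carrier) where

    -- The right-hand side of the theorem, in terms of the product P, the sums S = Σ δ and X = Σ χ δ, and σ = s*.
    potential : Carrier → Carrier → Carrier → Carrier → Carrier
    potential P S X σ = F - P * (F - S) + ((1# - c) / c) * (γ / (γ - σ)) * (1# - P) * (F - X)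

    -- One greedy step, with item size x, gain d and indicator χ, from `old` to `new`.
    module Step (x d σ χ S X P : Carrier) where
      K e u v h h′ a b q E A B W κ old new : Carrier
      K = (1# - c) / c
      e = (c * x) / γ
      u = γ - σ
      v = γ - (σ + χ * x)
      h = γ / u
      h′ = γ / v
      a = F - S
      b = F - X
      q = 1# - P
      E = u * d - x * (c * a + (1# - c) * b)
      A = d - e * a - K * h * e * b
      B = h′ * (b - χ * d) - h * b
      W = c * v - γ * q
      κ = c * γ * v * P - (1# - c) * γ * γ * χ * q
      old = potential ((1# - e) * P) S X σ
      new = potential P (S + d) (X + χ * d) (σ + χ * x)

      new-old≡ : new - old ≡ P * A + K * q * B
      new-old≡ = solve 10 (λ F S X d P K e h h′ χ →
          (F :- P :* (F :- (S :+ d)) :+ K :* h′ :* (:1 :- P) :* (F :- (X :+ χ :* d)))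
            :- (F :- (:1 :- e) :* P :* (F :- S) :+ K :* h :* (:1 :- (:1 :- e) :* P) :* (F :- X))
          := P :* (d :- e :* (F :- S) :- K :* h :* e :* (F :- X)) :+ K :* (:1 :- P) :* (h′ :* ((F :- X) :- χ :* d) :- h :* (F :- X)))
        refl F S X d P K e h h′ χ

      κ≡ : κ ≡ γ * W * P + γ * q * (γ * (1# - χ) * (1# - c) + c * (σ + χ * x) + W)
      κ≡ = solve 6 (λ c γ σ χ x P →
             c :* γ :* (γ :- (σ :+ χ :* x)) :* P :- (:1 :- c) :* γ :* γ :* χ :* (:1 :- P)
          := γ :* (c :* (γ :- (σ :+ χ :* x)) :- γ :* (:1 :- P)) :* P
             :+ γ :* (:1 :- P) :* (γ :* (:1 :- χ) :* (:1 :- c) :+ c :* (σ :+ χ :* x) :+ (c :* (γ :- (σ :+ χ :* x)) :- γ :* (:1 :- P))))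
        refl c γ σ χ x P

      module Cleared (c>0 : 0# < c) (γ>0 : 0# < γ) (u>0 : 0# < u) (v>0 : 0# < v) where
        Kc : K * c ≡ 1# - c
        Kc = x/y*y≡x (0<x⇒x≢0 c>0)
        eγ : e * γ ≡ c * x
        eγ = x/y*y≡x (0<x⇒x≢0 γ>0)
        hu : h * u ≡ γ
        hu = x/y*y≡x (0<x⇒x≢0 u>0)
        h′v : h′ * v ≡ γ
        h′v = x/y*y≡x (0<x⇒x≢0 v>0)

        Kheu : K * h * e * u ≡ (1# - c) * x
        Kheu = begin
          K * h * e * u   ≡⟨ solve 4 (λ K h e u → K :* h :* e :* u := K :* (h :* u) :* e) refl K h e u ⟩
          K * (h * u) * e ≡⟨ cong (λ t → K * t * e) hu ⟩
          K * γ * e       ≡⟨ solve 3 (λ K γ e → K :* γ :* e := K :* (e :* γ)) refl K γ e ⟩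
          K * (e * γ)     ≡⟨ cong (K *_) eγ ⟩
          K * (c * x)     ≡⟨ solve 3 (λ K c x → K :* (c :* x) := K :* c :* x) refl K c x ⟩
          K * c * x       ≡⟨ cong (_* x) Kc ⟩
          (1# - c) * x    ∎
          where open ≡-Reasoning

        uA≡ : u * A ≡ E + σ * (e * a)
        uA≡ = begin
          u * A
            ≡⟨ solve 8 (λ γ σ d e a K h b → (γ :- σ) :* (d :- e :* a :- K :* h :* e :* b)
                         := (γ :- σ) :* d :- e :* γ :* a :+ σ :* (e :* a) :- K :* h :* e :* (γ :- σ) :* b) refl γ σ d e a K h b ⟩
          u * d - e * γ * a + σ * (e * a) - K * h * e * u * b
            ≡⟨ cong₂ (λ s t → u * d - s * a + σ * (e * a) - t * b) eγ Kheu ⟩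
          u * d - c * x * a + σ * (e * a) - (1# - c) * x * b
            ≡⟨ solve 8 (λ u d c x a t b σ → u :* d :- c :* x :* a :+ t :- (:1 :- c) :* x :* b
                         := u :* d :- x :* (c :* a :+ (:1 :- c) :* b) :+ t) refl u d c x a (σ * (e * a)) b σ ⟩
          E + σ * (e * a)
            ∎
          where open ≡-Reasoning

        uvB≡ : u * v * B ≡ γ * χ * (c * x * (S - X) - E)
        uvB≡ = begin
          u * v * B
            ≡⟨ solve 7 (λ u v h′ h b χ d → u :* v :* (h′ :* (b :- χ :* d) :- h :* b)
                         := u :* (h′ :* v) :* (b :- χ :* d) :- v :* (h :* u) :* b) refl u v h′ h b χ d ⟩
          u * (h′ * v) * (b - χ * d) - v * (h * u) * b
            ≡⟨ cong₂ (λ s t → u * s * (b - χ * d) - v * t * b) h′v hu ⟩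
          u * γ * (b - χ * d) - v * γ * b
            ≡⟨ solve 9 (λ γ σ χ x d c F S X →
                   (γ :- σ) :* γ :* ((F :- X) :- χ :* d) :- (γ :- (σ :+ χ :* x)) :* γ :* (F :- X)
                := γ :* χ :* (c :* x :* (S :- X) :- ((γ :- σ) :* d :- x :* (c :* (F :- S) :+ (:1 :- c) :* (F :- X)))))
                refl γ σ χ x d c F S X ⟩
          γ * χ * (c * x * (S - X) - E)
            ∎
          where open ≡-Reasoning

        scaled-gain : c * γ * u * v * (new - old)
                      ≡ E * κ + c * c * v * P * σ * x * a + c * (1# - c) * γ * γ * χ * q * x * (S - X)
        scaled-gain = begin
          c * γ * u * v * (new - old)
            ≡⟨ cong (c * γ * u * v *_) new-old≡ ⟩
          c * γ * u * v * (P * A + K * q * B)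
            ≡⟨ solve 9 (λ c γ u v P A K q B → c :* γ :* u :* v :* (P :* A :+ K :* q :* B)
                          := c :* γ :* v :* P :* (u :* A) :+ γ :* (K :* c) :* q :* (u :* v :* B)) refl c γ u v P A K q B ⟩
          c * γ * v * P * (u * A) + γ * (K * c) * q * (u * v * B)
            ≡⟨ cong₂ _+_ (cong (c * γ * v * P *_) uA≡) (cong₂ (λ s t → γ * s * q * t) Kc uvB≡) ⟩
          c * γ * v * P * (E + σ * (e * a)) + γ * (1# - c) * q * (γ * χ * (c * x * (S - X) - E))
            ≡⟨ solve 13 (λ c γ v P E σ e a q χ x S X →
                   c :* γ :* v :* P :* (E :+ σ :* (e :* a)) :+ γ :* (:1 :- c) :* q :* (γ :* χ :* (c :* x :* (S :- X) :- E))
                := E :* (c :* γ :* v :* P :- (:1 :- c) :* γ :* γ :* χ :* q) :+ c :* v :* P :* σ :* (e :* γ) :* a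
                     :+ c :* (:1 :- c) :* γ :* γ :* χ :* q :* x :* (S :- X)) refl c γ v P E σ e a q χ x S X ⟩
          E * κ + c * v * P * σ * (e * γ) * a + c * (1# - c) * γ * γ * χ * q * x * (S - X)
            ≡⟨ cong (λ t → E * κ + c * v * P * σ * t * a + c * (1# - c) * γ * γ * χ * q * x * (S - X)) eγ ⟩
          E * κ + c * v * P * σ * (c * x) * a + c * (1# - c) * γ * γ * χ * q * x * (S - X)
            ≡⟨ cong (λ t → E * κ + t + c * (1# - c) * γ * γ * χ * q * x * (S - X))
                    (solve 6 (λ c v P σ x a → c :* v :* P :* σ :* (c :* x) :* a := c :* c :* v :* P :* σ :* x :* a) refl c v P σ x a) ⟩
          E * κ + c * c * v * P * σ * x * a + c * (1# - c) * γ * γ * χ * q * x * (S - X)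
            ∎
          where open ≡-Reasoning

    -- E ≥ 0 is the greedy gain inequality and W ≥ 0 the slack of the product, so scaled-gain is a sum of nonnegative terms.
    potential-step : ∀ {x d σ χ S X P} → 0# < c → c ≤ 1# → 0# < γ →
      0# ≤ x → 0# ≤ σ → 0# ≤ χ → χ ≤ 1# → S ≤ F → X ≤ S → 0# < γ - (σ + χ * x) →
      x * (c * (F - S) + (1# - c) * (F - X)) ≤ (γ - σ) * d →
      0# ≤ P → P ≤ 1# → γ * (1# - P) ≤ c * (γ - (σ + χ * x)) →
      potential ((1# - (c * x) / γ) * P) S X σ ≤ potential P (S + d) (X + χ * d) (σ + χ * x)
    potential-step {x} {d} {σ} {χ} {S} {X} {P} c>0 c≤1 γ>0 x≥0 σ≥0 χ≥0 χ≤1 S≤F X≤S v>0 gain P≥0 P≤1 slack =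
      0≤y-x⇒x≤y (*-cancelˡ-nonneg cγuv>0 (subst (0# ≤_) (sym scaled-gain) certificate≥0))
      where
      open Step x d σ χ S X P
      u>0 : 0# < u
      u>0 = <-≤-trans v>0 (-‿mono-≤ ≤-refl (x≤x+y (*-nonneg χ≥0 x≥0)))
      open Cleared c>0 γ>0 u>0 v>0
      cγuv>0 : 0# < c * γ * u * v
      cγuv>0 = *-pos (*-pos (*-pos c>0 γ>0) u>0) v>0

      infixl 6 _⊕_
      infixl 7 _⊛_
      _⊕_ : ∀ {s t} → 0# ≤ s → 0# ≤ t → 0# ≤ s + t
      _⊕_ = +-nonneg
      _⊛_ : ∀ {s t} → 0# ≤ s → 0# ≤ t → 0# ≤ s * t
      _⊛_ = *-nonneg

      c≥0 : 0# ≤ c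
      c≥0 = proj₁ c>0
      γ≥0 : 0# ≤ γ
      γ≥0 = proj₁ γ>0
      v≥0 : 0# ≤ v
      v≥0 = proj₁ v>0
      1-c≥0 : 0# ≤ 1# - c
      1-c≥0 = x≤y⇒0≤y-x c≤1
      1-χ≥0 : 0# ≤ 1# - χ
      1-χ≥0 = x≤y⇒0≤y-x χ≤1
      q≥0 : 0# ≤ q
      q≥0 = x≤y⇒0≤y-x P≤1
      a≥0 : 0# ≤ a
      a≥0 = x≤y⇒0≤y-x S≤F
      S-X≥0 : 0# ≤ S - X
      S-X≥0 = x≤y⇒0≤y-x X≤S
      E≥0 : 0# ≤ E
      E≥0 = x≤y⇒0≤y-x gain
      W≥0 : 0# ≤ W
      W≥0 = x≤y⇒0≤y-x slack
      κ≥0 : 0# ≤ κ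
      κ≥0 = subst (0# ≤_) (sym κ≡)
        (γ≥0 ⊛ W≥0 ⊛ P≥0 ⊕ γ≥0 ⊛ q≥0 ⊛ (γ≥0 ⊛ 1-χ≥0 ⊛ 1-c≥0 ⊕ c≥0 ⊛ (σ≥0 ⊕ χ≥0 ⊛ x≥0) ⊕ W≥0))

      certificate≥0 : 0# ≤ E * κ + c * c * v * P * σ * x * a + c * (1# - c) * γ * γ * χ * q * x * (S - X)
      certificate≥0 = E≥0 ⊛ κ≥0 ⊕ c≥0 ⊛ c≥0 ⊛ v≥0 ⊛ P≥0 ⊛ σ≥0 ⊛ x≥0 ⊛ a≥0
                    ⊕ c≥0 ⊛ 1-c≥0 ⊛ γ≥0 ⊛ γ≥0 ⊛ χ≥0 ⊛ q≥0 ⊛ x≥0 ⊛ S-X≥0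

  module GreedyAnalysis {n : ℕ}
    (s : Fin n → Carrier) (f : Subset n → Carrier) (γ c : Carrier) (O : Subset n) (xs : List (Fin n)) (k : ℕ)
    (s>0 : ∀ i → 0# < s i) (f≥0 : ∀ A → 0# ≤ f A)
    (normalized : Normalized s f) (monotone : Monotone s f) (submodular : Submodular s f)
    (f⁅⁆>0 : ∀ j → 0# < f ⁅ j ⁆) (curvature : IsCurvature s f c) (c>0 : 0# < c) (c≤1 : c ≤ 1#) (γ>0 : 0# < γ)
    (optimal : IsOpt s f γ O) (greedy : IsGreedyOrder s f γ xs) (k-max : IsK s f γ xs k) (Gk≢O : ¬ (Gs s f xs k ≡ O))
    where
    open SubmodularProperties f monotone submodular
    open GreedySequence s f γ O
    open Potential (f O) γ c

    G : ℕ → Subset n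
    G = Gs s f xs

    δ χ σ S X : ℕ → Carrier
    δ = δAt s f xs
    χ = χAt s f O xs
    σ = sStar s f O xs
    S = ΣR δ 0
    X = ΣR (λ m → χ m * δ m) 0

    s≥0 : ∀ i → 0# ≤ s i
    s≥0 i = proj₁ (s>0 i)

    choiceAt : ∀ {m} → m ℕ.< k → Choice (G m) (G (suc m)) (sAt s f xs (suc m)) (χ (suc m))
    choiceAt m<k = choice greedy (ℕP.<-≤-trans m<k (proj₁ k-max))

    sAt≥0 : ∀ {m} → m ℕ.< k → 0# ≤ sAt s f xs (suc m)
    sAt≥0 m<k = subst (0# ≤_) (sym (Choice.size (choiceAt m<k))) (s≥0 _)

    sz-G≤γ : ∀ {m} → m ℕ.≤ k → sz s f (G m) ≤ γ
    sz-G≤γ m≤k = ≤-trans (ΣIn-mono-⊆ s≥0 (Gs-mono xs m≤k)) (proj₁ (proj₂ k-max))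

    S≡f-G : ∀ l → S l ≡ f (G l)
    S≡f-G zero = sym normalized
    S≡f-G (suc l) = trans (cong (_+ δ (suc l)) (S≡f-G l)) (solve 2 (λ a b → a :+ (b :- a) := b) refl (f (G l)) (f (G (suc l))))

    δ≥0 : ∀ m → 0# ≤ δ m
    δ≥0 zero = ≤-refl
    δ≥0 (suc m) = x≤y⇒0≤y-x (monotone _ _ (Gs-mono xs (ℕP.n≤1+n m)))

    X≤S : ∀ l → X l ≤ S l
    X≤S zero = ≤-refl
    X≤S (suc l) = +-mono-≤ (X≤S l) (≤-trans (*-monoʳ-≤-nonneg (δ≥0 (suc l)) (proj₂ (χAt∈[0,1] xs (suc l)))) (≤-reflexive (*-identityˡ _)))

    f-G≤f-O : ∀ {m} → m ℕ.≤ k → f (G m) ≤ f O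
    f-G≤f-O {m} m≤k = proj₂ optimal (G m) (sz-G≤γ m≤k)

    σ≥0 : ∀ m → 0# ≤ σ m
    σ≥0 m = ΣIn-nonneg (O ∩ G m) s≥0

    σ≤sz-G : ∀ m → σ m ≤ sz s f (G m)
    σ≤sz-G m = ΣIn-mono-⊆ s≥0 (SubP.p∩q⊆q O (G m))

    γ-σ>0-witnessed : ∀ {m C y} → sz s f C ≤ γ → y ∈ C → y ∉ O ∩ G m → O ∩ G m ⊆ C → 0# < γ - σ m
    γ-σ>0-witnessed {m} {C} {y} szC≤γ y∈C y∉O∩Gm O∩Gm⊆C = <-≤-trans (s>0 y) (x+y≤z⇒y≤z-x (begin
      σ m + s y                  ≡⟨ ΣIn-∪-⁅⁆ s y∉O∩Gm ⟨
      sz s f ((O ∩ G m) ∪ ⁅ y ⁆) ≤⟨ ΣIn-mono-⊆ s≥0 (∪-⁅⁆-⊆ O∩Gm⊆C y∈C) ⟩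
      sz s f C                   ≤⟨ szC≤γ ⟩
      γ                          ∎))
      where open ≤-Reasoning

    -- G k ≠ Opt provides an element outside O ∩ G k that still fits next to O ∩ G m.
    γ-σ>0 : ∀ {m} → m ℕ.≤ k → 0# < γ - σ m
    γ-σ>0 {m} m≤k with ≢⇒∃-differ Gk≢O
    ... | y , inj₁ (y∈Gk , y∉O) =
      γ-σ>0-witnessed {m} (proj₁ (proj₂ k-max)) y∈Gk (λ y∈O∩Gm → y∉O (proj₁ (SubP.x∈p∩q⁻ O (G m) y∈O∩Gm)))
               (λ z∈O∩Gm → Gs-mono xs m≤k (proj₂ (SubP.x∈p∩q⁻ O (G m) z∈O∩Gm)))
    ... | y , inj₂ (y∉Gk , y∈O) =
      γ-σ>0-witnessed {m} (proj₁ optimal) y∈O (λ y∈O∩Gm → y∉Gk (Gs-mono xs m≤k (proj₂ (SubP.x∈p∩q⁻ O (G m) y∈O∩Gm))))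
               (SubP.p∩q⊆p O (G m))

    σ-suc : ∀ {m} → m ℕ.< k → σ (suc m) ≡ σ m + χ (suc m) * sAt s f xs (suc m)
    σ-suc {m} m<k = begin
      σ (suc m)                             ≡⟨ cong (λ H → sz s f (O ∩ H)) extends ⟩
      sz s f (O ∩ (G m ∪ ⁅ item ⁆))         ≡⟨ ΣIn-∩-∪-⁅⁆ s O fresh ⟩
      σ m + restrict O s item               ≡⟨ cong (σ m +_) (restrict≡indicator* O s item) ⟩
      σ m + (if lookup O item then 1# else 0#) * s item
                                            ≡⟨ cong₂ (λ a b → σ m + a * b) indicator size ⟨
      σ m + χ (suc m) * sAt s f xs (suc m)  ∎
      where
      open ≡-Reasoning
      open Choice (choiceAt m<k)

    sz-G-suc : ∀ {m} → m ℕ.< k → sz s f (G (suc m)) ≡ sz s f (G m) + sAt s f xs (suc m)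
    sz-G-suc {m} m<k = trans (cong (sz s f) extends) (trans (ΣIn-∪-⁅⁆ s fresh) (cong (sz s f (G m) +_) (sym size)))
      where open Choice (choiceAt m<k)

    δ-suc : ∀ {m} (m<k : m ℕ.< k) → δ (suc m) ≡ f (G m ∪ ⁅ Choice.item (choiceAt m<k) ⁆) - f (G m)
    δ-suc {m} m<k = cong (λ H → f H - f (G m)) (Choice.extends (choiceAt m<k))

    curvature-step : ∀ {m} → m ℕ.< k →
      f O + (1# - c) * (f (G m) - X m) ≤ f (G m ∪ O) →
      f O + (1# - c) * (f (G (suc m)) - X (suc m)) ≤ f (G (suc m) ∪ O)
    curvature-step {m} m<k ih = by-membership (item SubP.∈? O)
      where
      open Choice (choiceAt m<k)
      open ≤-Reasoning
      by-membership : Dec (item ∈ O) → f O + (1# - c) * (f (G (suc m)) - X (suc m)) ≤ f (G (suc m) ∪ O)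
      by-membership (yes item∈O) = begin
        f O + (1# - c) * (f (G (suc m)) - (X m + χ (suc m) * δ (suc m)))
          ≡⟨ cong (λ t → f O + (1# - c) * (f (G (suc m)) - (X m + t * δ (suc m)))) (indicator-∈ item∈O) ⟩
        f O + (1# - c) * (f (G (suc m)) - (X m + 1# * (f (G (suc m)) - f (G m))))
          ≡⟨ solve 5 (λ F c g′ x g → F :+ (:1 :- c) :* (g′ :- (x :+ :1 :* (g′ :- g))) := F :+ (:1 :- c) :* (g :- x))
               refl (f O) c (f (G (suc m))) (X m) (f (G m)) ⟩
        f O + (1# - c) * (f (G m) - X m)
          ≤⟨ ih ⟩
        f (G m ∪ O)
          ≡⟨ cong f absorb ⟨
        f (G (suc m) ∪ O)  ∎
        where
        absorb : G (suc m) ∪ O ≡ G m ∪ O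
        absorb = trans (cong (_∪ O) extends) (trans (SubP.∪-assoc (G m) ⁅ item ⁆ O)
                       (cong (G m ∪_) (⊆⇒∪≡ (λ y∈⁅i⁆ → subst (_∈ O) (sym (SubP.x∈⁅y⁆⇒x≡y item y∈⁅i⁆)) item∈O))))
      by-membership (no item∉O) = begin
        f O + (1# - c) * (f (G (suc m)) - (X m + χ (suc m) * δ (suc m)))
          ≡⟨ cong (λ t → f O + (1# - c) * (f (G (suc m)) - (X m + t * δ (suc m)))) (indicator-∉ item∉O) ⟩
        f O + (1# - c) * (f (G (suc m)) - (X m + 0# * δ (suc m)))
          ≡⟨ solve 5 (λ F c g′ x g → F :+ (:1 :- c) :* (g′ :- (x :+ :0 :* (g′ :- g))) := F :+ (:1 :- c) :* (g :- x) :+ (:1 :- c) :* (g′ :- g))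
               refl (f O) c (f (G (suc m))) (X m) (f (G m)) ⟩
        f O + (1# - c) * (f (G m) - X m) + (1# - c) * δ (suc m)
          ≤⟨ +-mono-≤ ih (≤-trans (*-monoˡ-≤-nonneg (x≤y⇒0≤y-x c≤1) δ≤f⁅i⁆) (curvature-marginal (f⁅⁆>0 item) (proj₁ curvature item) item∉Gm∪O)) ⟩
        f (G m ∪ O) + (f ((G m ∪ O) ∪ ⁅ item ⁆) - f (G m ∪ O))
          ≡⟨ solve 2 (λ a b → a :+ (b :- a) := b) refl (f (G m ∪ O)) (f ((G m ∪ O) ∪ ⁅ item ⁆)) ⟩
        f ((G m ∪ O) ∪ ⁅ item ⁆)
          ≡⟨ cong f regroup ⟨
        f (G (suc m) ∪ O)  ∎
        where
        δ≤f⁅i⁆ : δ (suc m) ≤ f ⁅ item ⁆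
        δ≤f⁅i⁆ = subst (_≤ f ⁅ item ⁆) (sym (δ-suc m<k)) (marginal≤singleton f≥0 (G m) item)
        item∉Gm∪O : item ∉ G m ∪ O
        item∉Gm∪O i∈ with SubP.x∈p∪q⁻ (G m) O i∈
        ... | inj₁ i∈Gm = fresh i∈Gm
        ... | inj₂ i∈O = item∉O i∈O
        regroup : G (suc m) ∪ O ≡ (G m ∪ O) ∪ ⁅ item ⁆
        regroup = trans (cong (_∪ O) extends) (∪-Solver.solve 3 (λ g i o → (g ⊕ i) ⊕ o ⊜ (g ⊕ o) ⊕ i) refl (G m) ⁅ item ⁆ O)
          where open ∪-Solver

    curvature-chain : ∀ m → m ℕ.≤ k → f O + (1# - c) * (f (G m) - X m) ≤ f (G m ∪ O)
    curvature-chain zero _ = ≤-reflexive (begin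
      f O + (1# - c) * (f Sub.⊥ - 0#)  ≡⟨ cong (λ t → f O + (1# - c) * (t - 0#)) normalized ⟩
      f O + (1# - c) * (0# - 0#)       ≡⟨ solve 2 (λ F c → F :+ (:1 :- c) :* (:0 :- :0) := F) refl (f O) c ⟩
      f O                              ≡⟨ cong f (SubP.∪-identityˡ O) ⟨
      f (Sub.⊥ ∪ O)                    ∎)
      where open ≡-Reasoning
    curvature-chain (suc m) m<k = curvature-step m<k (curvature-chain m (ℕP.<⇒≤ m<k))

    ∈O⇒s≤γ : ∀ {y} → y ∈ O → s y ≤ γ
    ∈O⇒s≤γ {y} y∈O = begin
      s y             ≡⟨ ΣIn-⁅⁆ s y ⟨
      sz s f ⁅ y ⁆    ≤⟨ ΣIn-mono-⊆ s≥0 (λ z∈⁅y⁆ → subst (_∈ O) (sym (SubP.x∈⁅y⁆⇒x≡y y z∈⁅y⁆)) y∈O) ⟩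
      sz s f O        ≤⟨ proj₁ optimal ⟩
      γ               ∎
      where open ≤-Reasoning

    marginal-weights : ∀ {H i} → (∀ y → s y ≤ γ → y ∉ H → ratio s f H y ≤ ratio s f H i) → ∀ y →
      s i * (f (H ∪ elements O y) - f H) + (f (H ∪ ⁅ i ⁆) - f H) * restrict (O ∩ H) s y
        ≤ (f (H ∪ ⁅ i ⁆) - f H) * restrict O s y
    marginal-weights {H} {i} best y rewrite lookup-zipWith _∧_ y O H with lookup O y in y∈O? | lookup H y in y∈H?
    ... | false | _ = ≤-reflexive (trans (cong (λ B → s i * (f B - f H) + d * 0#) (SubP.∪-identityʳ H))
                                         (solve 3 (λ x a d → x :* (a :- a) :+ d :* :0 := d :* :0) refl (s i) (f H) d))
      where
      d : Carrier
      d = f (H ∪ ⁅ i ⁆) - f H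
    ... | true | true = ≤-reflexive (trans (cong (λ B → s i * (f B - f H) + d * s y) absorb)
                                           (solve 4 (λ x a d t → x :* (a :- a) :+ d :* t := d :* t) refl (s i) (f H) d (s y)))
      where
      d : Carrier
      d = f (H ∪ ⁅ i ⁆) - f H
      absorb : H ∪ ⁅ y ⁆ ≡ H
      absorb = trans (SubP.∪-comm H ⁅ y ⁆) (⊆⇒∪≡ (λ z∈⁅y⁆ → subst (_∈ H) (sym (SubP.x∈⁅y⁆⇒x≡y y z∈⁅y⁆)) (lookup⇒[]= y H y∈H?)))
    ... | true | false = begin
      s i * (f (H ∪ ⁅ y ⁆) - f H) + d * 0#  ≡⟨ solve 3 (λ x a d → x :* a :+ d :* :0 := a :* x) refl (s i) (f (H ∪ ⁅ y ⁆) - f H) d ⟩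
      (f (H ∪ ⁅ y ⁆) - f H) * s i          ≤⟨ /≤/⇒*≤* (s>0 y) (s>0 i) (best y (∈O⇒s≤γ (lookup⇒[]= y O y∈O?)) (lookup≡false⇒∉ y∈H?)) ⟩
      d * s y                              ∎
      where
      open ≤-Reasoning
      d : Carrier
      d = f (H ∪ ⁅ i ⁆) - f H

    marginal-density-sum : ∀ {H i} → (∀ y → s y ≤ γ → y ∉ H → ratio s f H y ≤ ratio s f H i) →
      s i * ΣFin (λ y → f (H ∪ elements O y) - f H) + (f (H ∪ ⁅ i ⁆) - f H) * sz s f (O ∩ H)
        ≤ (f (H ∪ ⁅ i ⁆) - f H) * sz s f O
    marginal-density-sum {H} {i} best = begin
      s i * ΣFin M + d * sz s f (O ∩ H)
        ≡⟨ cong₂ _+_ (ΣFin-*ˡ (s i) M) (ΣFin-*ˡ d (restrict (O ∩ H) s)) ⟨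
      ΣFin (λ y → s i * M y) + ΣFin (λ y → d * restrict (O ∩ H) s y)
        ≡⟨ ΣFin-+ (λ y → s i * M y) (λ y → d * restrict (O ∩ H) s y) ⟨
      ΣFin (λ y → s i * M y + d * restrict (O ∩ H) s y)
        ≤⟨ ΣFin-mono (marginal-weights best) ⟩
      ΣFin (λ y → d * restrict O s y)
        ≡⟨ ΣFin-*ˡ d (restrict O s) ⟩
      d * sz s f O ∎
      where
      open ≤-Reasoning
      M : Fin n → Carrier
      M y = f (H ∪ elements O y) - f H
      d : Carrier
      d = f (H ∪ ⁅ i ⁆) - f H

    curvature-gap : ∀ {m} → m ℕ.≤ k → c * (f O - S m) + (1# - c) * (f O - X m) ≤ f (G m ∪ O) - f (G m)
    curvature-gap {m} m≤k = begin
      c * (f O - S m) + (1# - c) * (f O - X m)      ≡⟨ cong (λ t → c * (f O - t) + (1# - c) * (f O - X m)) (S≡f-G m) ⟩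
      c * (f O - f (G m)) + (1# - c) * (f O - X m)  ≡⟨ solve 4 (λ c F g x → c :* (F :- g) :+ (:1 :- c) :* (F :- x)
                                                                    := F :+ (:1 :- c) :* (g :- x) :- g) refl c (f O) (f (G m)) (X m) ⟩
      f O + (1# - c) * (f (G m) - X m) - f (G m)    ≤⟨ +-monoˡ-≤ (- f (G m)) (curvature-chain m m≤k) ⟩
      f (G m ∪ O) - f (G m)                          ∎
      where open ≤-Reasoning

    greedy-gain : ∀ {m} → m ℕ.< k →
      sAt s f xs (suc m) * (c * (f O - S m) + (1# - c) * (f O - X m)) ≤ (γ - σ m) * δ (suc m)
    greedy-gain {m} m<k rewrite Choice.size (choiceAt m<k) | δ-suc m<k = begin
      s item * (c * (f O - S m) + (1# - c) * (f O - X m))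
        ≤⟨ *-monoˡ-≤-nonneg (s≥0 item) (curvature-gap (ℕP.<⇒≤ m<k)) ⟩
      s item * (f (G m ∪ O) - f (G m))
        ≤⟨ *-monoˡ-≤-nonneg (s≥0 item) (x≤y+z⇒x-y≤z (submodular-elements (G m) O)) ⟩
      s item * ΣFin (λ y → f (G m ∪ elements O y) - f (G m))
        ≤⟨ x+y≤z⇒x≤z-y (marginal-density-sum best) ⟩
      d * sz s f O - d * σ m
        ≤⟨ +-monoˡ-≤ (- (d * σ m)) (*-monoˡ-≤-nonneg d≥0 (proj₁ optimal)) ⟩
      d * γ - d * σ m
        ≡⟨ solve 3 (λ d γ σ → d :* γ :- d :* σ := (γ :- σ) :* d) refl d γ (σ m) ⟩
      (γ - σ m) * d  ∎
      where
      open ≤-Reasoning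
      open Choice (choiceAt m<k)
      d : Carrier
      d = f (G m ∪ ⁅ item ⁆) - f (G m)
      d≥0 : 0# ≤ d
      d≥0 = subst (0# ≤_) (δ-suc m<k) (δ≥0 (suc m))

    e : ℕ → Carrier
    e m = (c * sAt s f xs m) / γ

    Π : ℕ → ℕ → Carrier
    Π = ΠR (λ m → 1# - e m)

    factor-bounds : ∀ {m} → m ℕ.< k →
      0# ≤ e (suc m) × e (suc m) ≤ 1# × γ * e (suc m) ≤ c * sz s f (G (suc m)) - c * sz s f (G m)
    factor-bounds {m} m<k = x/y-nonneg (*-nonneg (proj₁ c>0) x≥0) γ>0 , x≤y⇒x/y≤1 γ>0 cx≤γ , ≤-reflexive γe≡
      where
      open Choice (choiceAt m<k)
      x : Carrier
      x = sAt s f xs (suc m)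
      x≥0 : 0# ≤ x
      x≥0 = sAt≥0 m<k
      cx≤γ : c * x ≤ γ
      cx≤γ = ≤-trans (*-monoʳ-≤-nonneg x≥0 c≤1) (≤-trans (≤-reflexive (*-identityˡ x)) (subst (_≤ γ) (sym size) fits))
      γe≡ : γ * e (suc m) ≡ c * sz s f (G (suc m)) - c * sz s f (G m)
      γe≡ = begin
        γ * e (suc m)                               ≡⟨ *-comm γ _ ⟩
        e (suc m) * γ                               ≡⟨ x/y*y≡x (0<x⇒x≢0 γ>0) ⟩
        c * x                                       ≡⟨ solve 3 (λ c a x → c :* x := c :* (a :+ x) :- c :* a) refl c (sz s f (G m)) x ⟩
        c * (sz s f (G m) + x) - c * sz s f (G m)   ≡⟨ cong (λ t → c * t - c * sz s f (G m)) (sz-G-suc m<k) ⟨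
        c * sz s f (G (suc m)) - c * sz s f (G m)   ∎
        where open ≡-Reasoning

    Π∈[0,1] : ∀ {l j} → l ℕ.≤ j → j ℕ.≤ k → 0# ≤ Π l j × Π l j ≤ 1#
    Π∈[0,1] l≤j j≤k = ΠR-∈[0,1] (λ m → 1# - e m) l≤j λ _ m<j →
      let (e≥0 , e≤1 , _) = factor-bounds (ℕP.<-≤-trans m<j j≤k) in 1-x∈[0,1] e≥0 e≤1

    γ[1-Π]≤ : ∀ {l j} → l ℕ.≤ j → j ℕ.≤ k → γ * (1# - Π l j) ≤ c * sz s f (G j) - c * sz s f (G l)
    γ[1-Π]≤ l≤j j≤k = 1-ΠR≤ e (λ m → c * sz s f (G m)) (proj₁ γ>0) l≤j λ _ m<j → factor-bounds (ℕP.<-≤-trans m<j j≤k)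

    bound : ℕ → ℕ → Carrier
    bound l j = potential (Π l j) (S l) (X l) (σ l)

    bound-diag : ∀ j → bound j j ≡ f (G j)
    bound-diag j = begin
      potential (Π j j) (S j) (X j) (σ j)  ≡⟨ cong (λ P → potential P (S j) (X j) (σ j)) (ΠR-empty _ j) ⟩
      potential 1# (S j) (X j) (σ j)       ≡⟨ solve 4 (λ F S X t → F :- :1 :* (F :- S) :+ t :* (:1 :- :1) :* (F :- X) := S) refl (f O) (S j) (X j) _ ⟩
      S j                                  ≡⟨ S≡f-G j ⟩
      f (G j)                              ∎
      where open ≡-Reasoning

    bound-step : ∀ {l j} → l ℕ.< j → j ℕ.≤ k → bound l j ≤ bound (suc l) j
    bound-step {l} {j} l<j j≤k =
      subst₂ _≤_ (cong (λ P → potential P (S l) (X l) (σ l)) (sym (ΠR-cons (λ m → 1# - e m) l<j)))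
                 (cong (potential (Π (suc l) j) (S (suc l)) (X (suc l))) (sym (σ-suc l<k)))
        (potential-step c>0 c≤1 γ>0 (sAt≥0 l<k) (σ≥0 l) (proj₁ χ∈[0,1]) (proj₂ χ∈[0,1]) S≤f-O
          (X≤S l) room (greedy-gain l<k) (proj₁ P∈[0,1]) (proj₂ P∈[0,1]) slack)
      where
      l<k : l ℕ.< k
      l<k = ℕP.<-≤-trans l<j j≤k
      χ∈[0,1] : 0# ≤ χ (suc l) × χ (suc l) ≤ 1#
      χ∈[0,1] = χAt∈[0,1] xs (suc l)
      P∈[0,1] : 0# ≤ Π (suc l) j × Π (suc l) j ≤ 1#
      P∈[0,1] = Π∈[0,1] l<j j≤k
      S≤f-O : S l ≤ f O
      S≤f-O = subst (_≤ f O) (sym (S≡f-G l)) (f-G≤f-O (ℕP.<⇒≤ l<k))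
      σ′ : Carrier
      σ′ = σ l + χ (suc l) * sAt s f xs (suc l)
      room : 0# < γ - σ′
      room = subst (λ t → 0# < γ - t) (σ-suc l<k) (γ-σ>0 l<k)
      slack : γ * (1# - Π (suc l) j) ≤ c * (γ - σ′)
      slack = begin
        γ * (1# - Π (suc l) j)                            ≤⟨ γ[1-Π]≤ l<j j≤k ⟩
        c * sz s f (G j) - c * sz s f (G (suc l))         ≤⟨ -‿mono-≤ (*-monoˡ-≤-nonneg (proj₁ c>0) (sz-G≤γ j≤k)) (*-monoˡ-≤-nonneg (proj₁ c>0) (σ≤sz-G (suc l))) ⟩
        c * γ - c * σ (suc l)                             ≡⟨ cong (λ t → c * γ - c * t) (σ-suc l<k) ⟩
        c * γ - c * σ′                                    ≡⟨ solve 3 (λ c γ t → c :* γ :- c :* t := c :* (γ :- t)) refl c γ σ′ ⟩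
        c * (γ - σ′)                                      ∎
        where open ≤-Reasoning

lemma4 : (OF : OrderedField) → let open OrderedField OF in let open Greedy OF in
    {n : ℕ} (s : Fin n → Carrier) (f : Subset n → Carrier)
    (γ c : Carrier) (O : Subset n) (xs : List (Fin n)) (k : ℕ) →
    (∀ i → 0# < s i) →
    (∀ A → 0# ≤ f A) →
    Normalized s f → Monotone s f → Submodular s f →
    (∀ j → 0# < f ⁅ j ⁆) →
    IsCurvature s f c → 0# < c → c ≤ 1# →
    0# < γ →
    IsOpt s f γ O →
    IsGreedyOrder s f γ xs →
    IsK s f γ xs k →
    ¬ (Gs s f xs k ≡ O) →
    ∀ j l → 1 ℕ.≤ j → j ℕ.≤ k → l ℕ.≤ j →
      f O
        - ΠR (λ m → 1# - (c * sAt s f xs m) / γ) l j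
          * (f O - ΣR (δAt s f xs) 0 l)
        + ((1# - c) / c) * (γ / (γ - sStar s f O xs l))
          * (1# - ΠR (λ m → 1# - (c * sAt s f xs m) / γ) l j)
          * (f O - ΣR (λ m → χAt s f O xs m * δAt s f xs m) 0 l)
        ≤ f (Gs s f xs j)
lemma4 OF s f γ c O xs k s>0 f≥0 normalized monotone submodular f⁅⁆>0 curvature c>0 c≤1 γ>0 optimal greedy k-max Gk≢O
  j l _ j≤k l≤j = begin
    bound l j  ≤⟨ ≤-chain OF (λ m → bound m j) (λ _ m<j → bound-step m<j j≤k) l≤j ⟩
    bound j j  ≡⟨ bound-diag j ⟩
    f (G j)    ∎
  where
  open GreedyAnalysis OF s f γ c O xs k s>0 f≥0 normalized monotone submodular f⁅⁆>0 curvature c>0 c≤1 γ>0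
    optimal greedy k-max Gk≢O
  open ≤-Reasoning OF
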